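{- For every set partition $\phi$ of $[n]$, \[ p_\phi=\sum_{\Phi:\ \mathsf{sort}(\Phi)=\phi}P_\Phi , \] where the sum is over all set compositions $\Phi$ whose blocks, forgetting their order, form $\phi$.
   Context: Notation: $x_1,x_2,\dots$ are non-commuting variables. For a word $w=w_1\cdots w_n$ of positive integers, write $x_w=x_{w_1}\cdots x_{w_n}$. Power sums in $\mathrm{NCSym}$: for a set partition $\phi$ of $[n]$, $p_\phi=\sum x_w$, summed over words $w$ of length $n$ such that $w_j=w_k$ whenever $j,k$ lie in the same block of $\phi$. Set compositions: a set composition $\Phi=B_1|\cdots|B_k$ of $n$ is a sequence of nonempty pairwise disjoint sets with union $[n]$. Monomial basis of $\mathrm{NCQSym}$: for a word $w$ of length $n$ with distinct values $v_1<\dots<v_k$, let $\varrho(w)=B_1|\cdots|B_k$, where $B_j=\{i:w_i=v_j\}$. Then $M_\Phi=\sum_{w:\varrho(w)=\Phi}x_w$. Order on blocks: for disjoint sets $A,B$, write $A>_{\mathcal D}B$ if either $|A|>|B|$, or $|A|=|B|$ and $\min A<\min B$. LDD fillings: an LDD filling of $\Phi=B_1|\cdots|B_k$ is a placement of block $B_i$ in row $i$ of a matrix (one block per row, other entries empty) such that the following hold. - $B_1$ is in column 1. - For each $i$: if $B_i>_{\mathcal D}B_{i+1}$, then $B_{i+1}$ is in the same column as $B_i$ or in the next column; otherwise $B_{i+1}$ is in the next column. $\mathsf{LDD}(\Phi)$ is the set of such fillings. The column reading $\mathsf{col}(\tilde{\mathsf F})$ is the set composition listing, left to right, the union of the blocks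 in each nonempty column. The power sum basis of $\mathrm{NCQSym}$ is $P_\Phi=\sum_{\tilde{\mathsf F}\in\mathsf{LDD}(\Phi)}M_{\mathsf{col}(\tilde{\mathsf F})}$. -}

module Defs where

open import Data.Bool using (Bool; true; false; _∧_; _∨_; not; if_then_else_; T)
import Data.Bool.Properties as BoolP
open import Data.Nat using (ℕ; zero; suc; _+_; _≡ᵇ_; _<ᵇ_; _⊔_)
open import Data.Fin using (Fin; toℕ)
open import Data.Fin.Subset using (Subset; _∪_; _∩_; ∣_∣) renaming (⊥ to ∅; ⊤ to full)
open import Data.List using (List; []; _∷_; map; filter; concatMap; length; upTo; foldr; allFin)
open import Data.Bool.ListAction using (and; or)
open import Data.Nat.ListAction using (sum)
open import Data.Bool using (T?)
import Data.List.Properties as ListP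
open import Data.Vec using (Vec; []; _∷_; tabulate; lookup; toList)
import Data.Vec.Properties as VecP
open import Relation.Nullary.Decidable using (⌊_⌋)

-- Conventions.  [n] is modelled by Fin n (elements 0,…,n-1; only the
-- order of elements matters).
-- A set composition B₁|⋯|Bₖ is the list of its blocks, in order.
-- A set partition is represented canonically as the list of its blocks
-- sorted by increasing minimum element.

_==ˢ_ : ∀ {n} → Subset n → Subset n → Bool
A ==ˢ B = ⌊ VecP.≡-dec BoolP._≟_ A B ⌋

_==ᶜ_ : ∀ {n} → List (Subset n) → List (Subset n) → Bool
Φ ==ᶜ Ψ = ⌊ ListP.≡-dec (VecP.≡-dec BoolP._≟_) Φ Ψ ⌋

_∈ᵇ_ : ∀ {n} → Fin n → Subset n → Bool
i ∈ᵇ A = lookup A i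

nonempty : ∀ {n} → Subset n → Bool
nonempty {n} A = or (map (_∈ᵇ A) (allFin n))

-- minimum element of a subset (as a natural number; n if the set is empty)
minElt : ∀ {n} → Subset n → ℕ
minElt [] = 0
minElt (true ∷ A) = 0
minElt (false ∷ A) = suc (minElt A)

disjoint : ∀ {n} → Subset n → Subset n → Bool
disjoint A B = (A ∩ B) ==ˢ ∅

pairwiseDisjoint : ∀ {n} → List (Subset n) → Bool
pairwiseDisjoint [] = true
pairwiseDisjoint (B ∷ Bs) = and (map (disjoint B) Bs) ∧ pairwiseDisjoint Bs

unionAll : ∀ {n} → List (Subset n) → Subset n
unionAll = foldr _∪_ ∅

isSetComposition : ∀ {n} → List (Subset n) → Bool
isSetComposition Φ = and (map nonempty Φ) ∧ pairwiseDisjoint Φ ∧ (unionAll Φ ==ˢ full)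

-- sort(Φ): forget the order of the blocks, i.e. list them by increasing minimum
insertBlock : ∀ {n} → Subset n → List (Subset n) → List (Subset n)
insertBlock B [] = B ∷ []
insertBlock B (C ∷ Cs) = if minElt B <ᵇ minElt C then B ∷ C ∷ Cs else C ∷ insertBlock B Cs

sortBlocks : ∀ {n} → List (Subset n) → List (Subset n)
sortBlocks = foldr insertBlock []

isSetPartition : ∀ {n} → List (Subset n) → Bool
isSetPartition φ = isSetComposition φ ∧ (sortBlocks φ ==ᶜ φ)

allSubsets : ∀ n → List (Subset n)
allSubsets zero = [] ∷ []
allSubsets (suc n) = concatMap (λ s → (false ∷ s) ∷ (true ∷ s) ∷ []) (allSubsets n)

listsOf : ∀ {a} {A : Set a} → ℕ → List A → List (List A)
listsOf zero xs = [] ∷ []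
listsOf (suc k) xs = concatMap (λ x → map (x ∷_) (listsOf k xs)) xs

-- every set composition of [n] has at most n blocks, so this list
-- (without repetitions) contains all of them
candidateCompositions : ∀ n → List (List (Subset n))
candidateCompositions n = concatMap (λ k → listsOf k (allSubsets n)) (upTo (suc n))

compositionsOver : ∀ {n} → List (Subset n) → List (List (Subset n))
compositionsOver {n} φ =
  filter (λ Φ → T? (isSetComposition Φ ∧ (sortBlocks Φ ==ᶜ φ))) (candidateCompositions n)

Word : ℕ → Set
Word n = Vec ℕ n

valuesOf : ∀ {n} → Word n → List ℕ
valuesOf {n} w = filter (λ v → T? (or (map (λ i → lookup w i ≡ᵇ v) (allFin n))))
                        (upTo (suc (foldr _⊔_ 0 (toList w))))

ϱ : ∀ {n} → Word n → List (Subset n)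
ϱ w = map (λ v → tabulate (λ i → lookup w i ≡ᵇ v)) (valuesOf w)

-- coefficient of x_w in M_Ψ
coeffM : ∀ {n} → List (Subset n) → Word n → ℕ
coeffM Ψ w = if ϱ w ==ᶜ Ψ then 1 else 0

-- Power sums of NCSym: coefficient of x_w in p_φ

constantOnBlocks : ∀ {n} → List (Subset n) → Word n → Bool
constantOnBlocks {n} φ w =
  and (map (λ B → and (map (λ j → and (map (λ k →
        not (j ∈ᵇ B ∧ k ∈ᵇ B) ∨ (lookup w j ≡ᵇ lookup w k)) (allFin n))) (allFin n))) φ)

coeffp : ∀ {n} → List (Subset n) → Word n → ℕ
coeffp φ w = if constantOnBlocks φ w then 1 else 0

-- LDD fillings.  A filling of Φ = B₁|⋯|Bₖ places Bᵢ in row i; it is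
-- recorded by the list of the columns (c₁,…,cₖ) (columns numbered from 1).

_>D_ : ∀ {n} → Subset n → Subset n → Bool
A >D B = (∣ B ∣ <ᵇ ∣ A ∣) ∨ ((∣ A ∣ ≡ᵇ ∣ B ∣) ∧ (minElt A <ᵇ minElt B))

lddSteps : ∀ {n} → List (Subset n) → List ℕ → Bool
lddSteps (A ∷ B ∷ Bs) (c ∷ d ∷ cs) =
  (if A >D B then (d ≡ᵇ c) ∨ (d ≡ᵇ suc c) else (d ≡ᵇ suc c)) ∧ lddSteps (B ∷ Bs) (d ∷ cs)
lddSteps (A ∷ []) (c ∷ []) = true
lddSteps [] [] = true
lddSteps _ _ = false

isLDD : ∀ {n} → List (Subset n) → List ℕ → Bool
isLDD [] [] = true
isLDD (B ∷ Bs) (c ∷ cs) = (c ≡ᵇ 1) ∧ lddSteps (B ∷ Bs) (c ∷ cs)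
isLDD _ _ = false

-- all fillings of Φ: column lists with entries in 1..k, k = number of blocks
-- (an LDD filling never uses a column beyond k)
allFillings : ∀ {n} → List (Subset n) → List (List ℕ)
allFillings Φ = listsOf (length Φ) (map suc (upTo (length Φ)))

LDD : ∀ {n} → List (Subset n) → List (List ℕ)
LDD Φ = filter (λ cs → T? (isLDD Φ cs)) (allFillings Φ)

inColumn : ∀ {n} → List (Subset n) → List ℕ → ℕ → List (Subset n)
inColumn (B ∷ Bs) (d ∷ ds) c = if d ≡ᵇ c then B ∷ inColumn Bs ds c else inColumn Bs ds c
inColumn _ _ c = []

colReading : ∀ {n} → List (Subset n) → List ℕ → List (Subset n)
colReading Φ cs =
  map (λ c → unionAll (inColumn Φ cs c))
      (filter (λ c → T? (nonemptyList (inColumn Φ cs c)))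
              (map suc (upTo (foldr _⊔_ 0 cs))))
  where
  nonemptyList : ∀ {A : Set} → List A → Bool
  nonemptyList [] = false
  nonemptyList (_ ∷ _) = true

-- coefficient of x_w in P_Φ = Σ_{F ∈ LDD(Φ)} M_{col(F)}
coeffP : ∀ {n} → List (Subset n) → Word n → ℕ
coeffP Φ w = sum (map (λ cs → coeffM (colReading Φ cs) w) (LDD Φ))

module Submission where

-- The coefficient of x_w in P_Φ counts the LDD fillings of Φ whose column reading is ϱ(w),
-- i.e. whose columns, read from left to right, are the level sets of w in increasing order
-- of value.  In such a filling w is constant on every block; the rows of one column share a
-- value and, by the LDD rule, strictly decrease for >_D, while passing to the next column
-- raises the value.  So the rows increase strictly for the order "smaller value of w, or
-- equal value and larger for >_D", which is total on the blocks of φ.  Hence no pair (Φ, F)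
-- with sort(Φ) = φ contributes to x_w unless w is constant on the blocks of φ, and then
-- exactly one does: the blocks listed in that order, with one column per value.  Both sides
-- are thus 1 or 0 according as w is or is not constant on the blocks of φ.

open import Defs
open import Data.Bool using (Bool; true; false; _∧_; _∨_; not; if_then_else_; T; T?)
open import Data.Bool.Properties using (T-∧; T-∨; T-≡; T-not-≡)
open import Data.Bool.ListAction using (all; any)
open import Data.Empty using (⊥; ⊥-elim)
open import Data.Fin using (Fin)
open import Data.Fin.Subset using (Subset; _∪_; ∣_∣; Nonempty) renaming (_∈_ to _∈ˢ_; ⊥ to ∅; ⊤ to full)
open import Data.Fin.Subset.Properties
  using (∉⊥; ∈⊤; ⊆-antisym; x∈p∪q⁺; x∈p∪q⁻; x∈p∩q⁺; x∈p∩q⁻; ∣⊤∣≡n)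
open import Data.List
  using (List; []; _∷_; _++_; map; filter; concat; concatMap; length; upTo; applyUpTo; foldr; allFin)
open import Data.List.Properties
  using ( map-++; map-∘; map-cong; map-cong-local; foldr-++; length-map; length-++; ++-identityʳ
        ; filter-all; map-applyUpTo; ∷-injective)
open import Data.List.Membership.Propositional using (_∈_; find; lose)
open import Data.List.Membership.Propositional.Properties
open import Data.List.Relation.Unary.All as All using (All; []; _∷_)
import Data.List.Relation.Unary.All.Properties as Allₚ
open Allₚ using (all⁺; all⁻)
open import Data.List.Relation.Unary.Any using (here; there)
open import Data.List.Relation.Unary.Any.Properties using (any⁺; any⁻)
open import Data.List.Relation.Unary.AllPairs as AllPairs using (AllPairs; []; _∷_)
import Data.List.Relation.Unary.AllPairs.Properties as AllPairsₚ
open import Data.List.Relation.Unary.Linked using (Linked; []; [-]; _∷_)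
open import Data.List.Relation.Unary.Linked.Properties using (Linked⇒AllPairs)
open import Data.Nat using (ℕ; zero; suc; _+_; _≤_; _<_; z≤n; s≤s; _≡ᵇ_; _<ᵇ_; _⊔_)
open import Data.Nat.ListAction using (sum)
open import Data.Nat.ListAction.Properties using (sum-++)
open import Data.Nat.Properties
open import Data.Product using (∃; _×_; _,_; proj₁; proj₂)
open import Data.Sum using (_⊎_; inj₁; inj₂)
open import Data.Unit using (⊤; tt)
open import Data.Vec using (Vec; []; _∷_; lookup; tabulate; toList; here; there)
import Data.Vec.Properties as Vecₚ
import Data.List.Properties as ListP
import Data.Bool.Properties as BoolP
open import Function using (_∘_; id)
open import Function.Bundles using (Equivalence)
open import Relation.Binary.PropositionalEquality
open import Relation.Binary.Definitions using (tri<; tri≈; tri>)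
open import Relation.Nullary using (¬_)
open import Relation.Nullary.Decidable using (toWitness; fromWitness)
open import Relation.Unary using (Decidable)

∧-elim : ∀ {a b} → T (a ∧ b) → T a × T b
∧-elim {a} = Equivalence.to (T-∧ {a})

∧-intro : ∀ {a b} → T a → T b → T (a ∧ b)
∧-intro {a} p q = Equivalence.from (T-∧ {a}) (p , q)

∨-elim : ∀ {a b} → T (a ∨ b) → T a ⊎ T b
∨-elim {a} = Equivalence.to (T-∨ {a})

∨-introˡ : ∀ {a b} → T a → T (a ∨ b)
∨-introˡ {a} p = Equivalence.from (T-∨ {a}) (inj₁ p)

∨-introʳ : ∀ {a b} → T b → T (a ∨ b)
∨-introʳ {a} q = Equivalence.from (T-∨ {a}) (inj₂ q)

T⇒≡true : ∀ {a} → T a → a ≡ true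
T⇒≡true = Equivalence.to T-≡

≡true⇒T : ∀ {a} → a ≡ true → T a
≡true⇒T = Equivalence.from T-≡

¬T⇒≡false : ∀ {a} → ¬ T a → a ≡ false
¬T⇒≡false {false} _  = refl
¬T⇒≡false {true}  ¬t = ⊥-elim (¬t tt)

≡ᵇ-refl : ∀ m → (m ≡ᵇ m) ≡ true
≡ᵇ-refl m = T⇒≡true (≡⇒≡ᵇ m m refl)

NonEmptyList : {A : Set} → List A → Set
NonEmptyList []      = ⊥
NonEmptyList (_ ∷ _) = ⊤

∈⇒NonEmptyList : {A : Set} {x : A} {xs : List A} → x ∈ xs → NonEmptyList xs
∈⇒NonEmptyList (here _)  = tt
∈⇒NonEmptyList (there _) = tt

range : ℕ → ℕ → List ℕ
range s zero    = []
range s (suc m) = s ∷ range (suc s) m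

∈-range⁻ : ∀ {s m c} → c ∈ range s m → s ≤ c × c < s + m
∈-range⁻ {s} {suc m} (here refl) = ≤-refl , m<m+n s (s≤s z≤n)
∈-range⁻ {s} {suc m} {c} (there c∈) with ∈-range⁻ c∈
... | s<c , c<s+1+m = <⇒≤ s<c , subst (λ k → c < k) (sym (+-suc s m)) c<s+1+m

range≡map-suc-upTo : ∀ m → map suc (upTo m) ≡ range 1 m
range≡map-suc-upTo m = trans (map-applyUpTo id suc m) (applyUpTo≡range suc 1 m (λ _ → refl))
  where
  applyUpTo≡range : ∀ f s m → (∀ k → f k ≡ s + k) → applyUpTo f m ≡ range s m
  applyUpTo≡range f s zero    _  = refl
  applyUpTo≡range f s (suc m) f≗ =
    cong₂ _∷_ (trans (f≗ 0) (+-identityʳ s))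
              (applyUpTo≡range (f ∘ suc) (suc s) m (λ k → trans (f≗ (suc k)) (+-suc s k)))

sum-concatMap : {A B : Set} (f : B → ℕ) (g : A → List B) (xs : List A) →
  sum (map f (concatMap g xs)) ≡ sum (map (λ x → sum (map f (g x))) xs)
sum-concatMap f g []       = refl
sum-concatMap f g (x ∷ xs) =
  trans (cong sum (map-++ f (g x) (concatMap g xs)))
        (trans (sum-++ (map f (g x)) _) (cong (sum (map f (g x)) +_) (sum-concatMap f g xs)))

sum-map-filter : {A : Set} (f : A → ℕ) (p : A → Bool) (xs : List A) →
  sum (map f (filter (T? ∘ p) xs)) ≡ sum (map (λ x → if p x then f x else 0) xs)
sum-map-filter f p []       = refl
sum-map-filter f p (x ∷ xs) with p x
... | true  = cong (f x +_) (sum-map-filter f p xs)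
... | false = sum-map-filter f p xs

sum-map-≡0 : {A : Set} (f : A → ℕ) (xs : List A) → (∀ {x} → x ∈ xs → f x ≡ 0) → sum (map f xs) ≡ 0
sum-map-≡0 f []       _  = refl
sum-map-≡0 f (x ∷ xs) f≡0 rewrite f≡0 (here refl) = sum-map-≡0 f xs (f≡0 ∘ there)

SupportedAt : {A : Set} → (A → ℕ) → A → Set
SupportedAt f a = ∀ x → x ≢ a → f x ≡ 0

-- "a occurs exactly once in xs", in the form used for counting.
OccursOnce : {A : Set} → List A → A → Set
OccursOnce xs a = ∀ f → SupportedAt f a → sum (map f xs) ≡ f a

occursOnce-map : {A B : Set} (g : A → B) → (∀ {x y} → g x ≡ g y → x ≡ y) →
  ∀ {xs a} → OccursOnce xs a → OccursOnce (map g xs) (g a)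
occursOnce-map g g-inj {xs} once f supp =
  trans (cong sum (sym (map-∘ xs))) (once (f ∘ g) (λ x x≢a → supp (g x) (x≢a ∘ g-inj)))

occursOnce-applyUpTo : {A : Set} (g : ℕ → A) → (∀ {i j} → g i ≡ g j → i ≡ j) →
  ∀ {m i} → i < m → OccursOnce (applyUpTo g m) (g i)
occursOnce-applyUpTo g g-inj {suc m} {zero} _ f supp =
  trans (cong (f (g 0) +_) (sum-map-≡0 f (applyUpTo (g ∘ suc) m) later≡0)) (+-identityʳ _)
  where
  later≡0 : ∀ {x} → x ∈ applyUpTo (g ∘ suc) m → f x ≡ 0
  later≡0 x∈ with ∈-applyUpTo⁻ (g ∘ suc) x∈
  ... | _ , _ , refl = supp _ (λ e → 0≢1+n (sym (g-inj e)))
occursOnce-applyUpTo g g-inj {suc m} {suc i} (s≤s i<m) f supp =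
  trans (cong (_+ sum (map f (applyUpTo (g ∘ suc) m))) (supp (g 0) (λ e → 0≢1+n (g-inj e))))
        (occursOnce-applyUpTo (g ∘ suc) (suc-injective ∘ g-inj) i<m f supp)

occursOnce-upTo : ∀ {m i} → i < m → OccursOnce (upTo m) i
occursOnce-upTo = occursOnce-applyUpTo id id

sum-listsOf-suc : {A : Set} (k : ℕ) (xs : List A) (f : List A → ℕ) →
  sum (map f (listsOf (suc k) xs)) ≡ sum (map (λ x → sum (map (f ∘ (x ∷_)) (listsOf k xs))) xs)
sum-listsOf-suc k xs f =
  trans (sum-concatMap f (λ x → map (x ∷_) (listsOf k xs)) xs)
        (cong sum (map-cong (λ x → cong sum (sym (map-∘ (listsOf k xs)))) xs))

listsOf-vanishes : {A : Set} (k : ℕ) (xs a : List A) (f : List A → ℕ) →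
  length a ≢ k → SupportedAt f a → sum (map f (listsOf k xs)) ≡ 0
listsOf-vanishes zero    xs []      f k≢ _    = ⊥-elim (k≢ refl)
listsOf-vanishes zero    xs (_ ∷ _) f _  supp = trans (+-identityʳ _) (supp [] (λ ()))
listsOf-vanishes (suc k) xs a       f k≢ supp =
  trans (sum-listsOf-suc k xs f) (sum-map-≡0 _ xs (λ {x} _ → rest x a k≢ supp))
  where
  rest : ∀ x a → length a ≢ suc k → SupportedAt f a → sum (map (f ∘ (x ∷_)) (listsOf k xs)) ≡ 0
  rest x []      _  supp = sum-map-≡0 _ (listsOf k xs) (λ {ys} _ → supp (x ∷ ys) (λ ()))
  rest x (b ∷ a) k≢ supp =
    listsOf-vanishes k xs a (f ∘ (x ∷_)) (k≢ ∘ cong suc)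
      (λ ys ys≢a → supp (x ∷ ys) (ys≢a ∘ proj₂ ∘ ∷-injective))

occursOnce-listsOf : {A : Set} (k : ℕ) (xs a : List A) →
  length a ≡ k → All (OccursOnce xs) a → OccursOnce (listsOf k xs) a
occursOnce-listsOf zero    xs []      _ _ f _ = +-identityʳ _
occursOnce-listsOf (suc k) xs (b ∷ a) len (once-b ∷ once-a) f supp =
  trans (sum-listsOf-suc k xs f)
        (trans (once-b _ (λ x x≢b → listsOf-vanishes-head x x≢b))
               (occursOnce-listsOf k xs a (suc-injective len) once-a (f ∘ (b ∷_))
                  (λ ys ys≢a → supp (b ∷ ys) (ys≢a ∘ proj₂ ∘ ∷-injective))))
  where
  listsOf-vanishes-head : ∀ x → x ≢ b → sum (map (f ∘ (x ∷_)) (listsOf k xs)) ≡ 0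
  listsOf-vanishes-head x x≢b =
    sum-map-≡0 _ (listsOf k xs) (λ {ys} _ → supp (x ∷ ys) (x≢b ∘ proj₁ ∘ ∷-injective))

occursOnce-allSubsets : ∀ n (a : Subset n) → OccursOnce (allSubsets n) a
occursOnce-allSubsets zero    []      f supp = +-identityʳ _
occursOnce-allSubsets (suc n) (b ∷ a) f supp =
  trans (sum-concatMap f (λ s → (false ∷ s) ∷ (true ∷ s) ∷ []) (allSubsets n))
        (trans (occursOnce-allSubsets n a _ others-vanish) (pick b supp))
  where
  pick : ∀ b → SupportedAt f (b ∷ a) → f (false ∷ a) + (f (true ∷ a) + 0) ≡ f (b ∷ a)
  pick false supp rewrite supp (true ∷ a) (λ ()) = +-identityʳ _
  pick true  supp rewrite supp (false ∷ a) (λ ()) = +-identityʳ _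
  others-vanish : SupportedAt (λ s → f (false ∷ s) + (f (true ∷ s) + 0)) a
  others-vanish s s≢a =
    cong₂ _+_ (supp _ (s≢a ∘ Vecₚ.∷-injectiveʳ)) (cong (_+ 0) (supp _ (s≢a ∘ Vecₚ.∷-injectiveʳ)))

module _ {A : Set} {R : A → A → Set} where

  AllPairs-mapWith∈ : {S : A → A → Set} {xs : List A} → AllPairs R xs →
    (∀ {x y} → x ∈ xs → y ∈ xs → R x y → S x y) → AllPairs S xs
  AllPairs-mapWith∈ []         _ = []
  AllPairs-mapWith∈ (Rx ∷ Rxs) h =
    All.tabulate (λ y∈ → h (here refl) (there y∈) (All.lookup Rx y∈))
    ∷ AllPairs-mapWith∈ Rxs (λ x∈ y∈ → h (there x∈) (there y∈))

  AllPairs-∈ : (∀ {x y} → R x y → R y x) → ∀ {xs} → AllPairs R xs →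
    ∀ {x y} → x ∈ xs → y ∈ xs → x ≡ y ⊎ R x y
  AllPairs-∈ sym (Rx ∷ Rxs) (here refl) (here refl) = inj₁ refl
  AllPairs-∈ sym (Rx ∷ Rxs) (here refl) (there y∈)  = inj₂ (All.lookup Rx y∈)
  AllPairs-∈ sym (Rx ∷ Rxs) (there x∈)  (here refl) = inj₂ (sym (All.lookup Rx x∈))
  AllPairs-∈ sym (Rx ∷ Rxs) (there x∈)  (there y∈)  = AllPairs-∈ sym Rxs x∈ y∈

  module _ (R-irrefl : ∀ {x} → ¬ R x x) (R-asym : ∀ {x y} → R x y → ¬ R y x) where

    AllPairs-along : {Q : A → A → Set} {xs : List A} → AllPairs Q xs → AllPairs R xs →
      ∀ {x y} → x ∈ xs → y ∈ xs → R x y → Q x y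
    AllPairs-along (Qx ∷ _)   (Rx ∷ _)   (here refl) (here refl) Rxy = ⊥-elim (R-irrefl Rxy)
    AllPairs-along (Qx ∷ _)   (Rx ∷ _)   (here refl) (there y∈)  Rxy = All.lookup Qx y∈
    AllPairs-along (Qx ∷ _)   (Rx ∷ _)   (there x∈)  (here refl) Rxy = ⊥-elim (R-asym Rxy (All.lookup Rx x∈))
    AllPairs-along (_ ∷ Qxs) (_ ∷ Rxs) (there x∈)  (there y∈)  Rxy = AllPairs-along Qxs Rxs x∈ y∈ Rxy

    strictlySorted-unique : ∀ {xs ys} → AllPairs R xs → AllPairs R ys →
      (∀ {z} → z ∈ xs → z ∈ ys) → (∀ {z} → z ∈ ys → z ∈ xs) → xs ≡ ys
    strictlySorted-unique {[]}     {[]}     _ _ _ _ = refl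
    strictlySorted-unique {[]}     {y ∷ ys} _ _ _ ys⊆ with ys⊆ (here refl)
    ... | ()
    strictlySorted-unique {x ∷ xs} {[]}     _ _ xs⊆ _ with xs⊆ (here refl)
    ... | ()
    strictlySorted-unique {x ∷ xs} {y ∷ ys} (Rx ∷ Rxs) (Ry ∷ Rys) xs⊆ ys⊆ with heads
      where
      heads : x ≡ y
      heads with xs⊆ (here refl) | ys⊆ (here refl)
      ... | here x≡y  | _          = x≡y
      ... | there _   | here y≡x   = sym y≡x
      ... | there x∈  | there y∈   = ⊥-elim (R-asym (All.lookup Ry x∈) (All.lookup Rx y∈))
    ... | refl = cong (x ∷_) (strictlySorted-unique Rxs Rys (tail⊆ Rx xs⊆) (tail⊆ Ry ys⊆))
      where
      tail⊆ : ∀ {us vs} → All (R x) us → (∀ {z} → z ∈ x ∷ us → z ∈ x ∷ vs) →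
              ∀ {z} → z ∈ us → z ∈ vs
      tail⊆ Rx-us us⊆ z∈ with us⊆ (there z∈)
      ... | here refl = ⊥-elim (R-irrefl (All.lookup Rx-us z∈))
      ... | there z∈′ = z∈′

module InsertionSort {A : Set} (_≺?_ : A → A → Bool) where

  insert : A → List A → List A
  insert x []       = x ∷ []
  insert x (y ∷ ys) = if x ≺? y then x ∷ y ∷ ys else y ∷ insert x ys

  sort : List A → List A
  sort = foldr insert []

  ∈-insert⁻ : ∀ {x z} ys → z ∈ insert x ys → z ≡ x ⊎ z ∈ ys
  ∈-insert⁻ []       (here z≡x) = inj₁ z≡x
  ∈-insert⁻ {x} (y ∷ ys) z∈ with x ≺? y
  ∈-insert⁻ (y ∷ ys) (here z≡x)  | true  = inj₁ z≡x
  ∈-insert⁻ (y ∷ ys) (there z∈)  | true  = inj₂ z∈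
  ∈-insert⁻ (y ∷ ys) (here z≡y)  | false = inj₂ (here z≡y)
  ∈-insert⁻ (y ∷ ys) (there z∈)  | false with ∈-insert⁻ ys z∈
  ... | inj₁ z≡x = inj₁ z≡x
  ... | inj₂ z∈′ = inj₂ (there z∈′)

  ∈-insert⁺ˡ : ∀ x ys → x ∈ insert x ys
  ∈-insert⁺ˡ x []       = here refl
  ∈-insert⁺ˡ x (y ∷ ys) with x ≺? y
  ... | true  = here refl
  ... | false = there (∈-insert⁺ˡ x ys)

  ∈-insert⁺ʳ : ∀ x {z} ys → z ∈ ys → z ∈ insert x ys
  ∈-insert⁺ʳ x (y ∷ ys) z∈ with x ≺? y
  ∈-insert⁺ʳ x (y ∷ ys) z∈          | true  = there z∈
  ∈-insert⁺ʳ x (y ∷ ys) (here z≡y)  | false = here z≡y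
  ∈-insert⁺ʳ x (y ∷ ys) (there z∈)  | false = there (∈-insert⁺ʳ x ys z∈)

  ∈-sort⁻ : ∀ {z} xs → z ∈ sort xs → z ∈ xs
  ∈-sort⁻ (x ∷ xs) z∈ with ∈-insert⁻ (sort xs) z∈
  ... | inj₁ refl = here refl
  ... | inj₂ z∈′  = there (∈-sort⁻ xs z∈′)

  ∈-sort⁺ : ∀ {z} xs → z ∈ xs → z ∈ sort xs
  ∈-sort⁺ (x ∷ xs) (here refl) = ∈-insert⁺ˡ x (sort xs)
  ∈-sort⁺ (x ∷ xs) (there z∈)  = ∈-insert⁺ʳ x (sort xs) (∈-sort⁺ xs z∈)

  module _ {_≺_ : A → A → Set}
           (≺?⇒≺ : ∀ {x y} → T (x ≺? y) → x ≺ y) (≺⇒≺? : ∀ {x y} → x ≺ y → T (x ≺? y))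
           (≺-trans : ∀ {x y z} → x ≺ y → y ≺ z → x ≺ z) where

    Comparable : A → A → Set
    Comparable x y = x ≺ y ⊎ y ≺ x

    ≺?≡false⇒≻ : ∀ {x y} → (x ≺? y) ≡ false → Comparable x y → y ≺ x
    ≺?≡false⇒≻ eq (inj₁ x≺y) = ⊥-elim (subst T eq (≺⇒≺? x≺y))
    ≺?≡false⇒≻ eq (inj₂ y≺x) = y≺x

    insert-sorted : ∀ x ys → All (Comparable x) ys → AllPairs _≺_ ys → AllPairs _≺_ (insert x ys)
    insert-sorted x []       _                  _            = [] ∷ []
    insert-sorted x (y ∷ ys) (x~y ∷ x~ys) (y≺ys ∷ ys↑) with x ≺? y in eq
    ... | true  = (x≺y ∷ All.map (≺-trans x≺y) y≺ys) ∷ y≺ys ∷ ys↑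
      where
      x≺y : x ≺ y
      x≺y = ≺?⇒≺ (≡true⇒T eq)
    ... | false = All.tabulate y≺ ∷ insert-sorted x ys x~ys ys↑
      where
      y≺x : y ≺ x
      y≺x = ≺?≡false⇒≻ eq x~y
      y≺ : ∀ {z} → z ∈ insert x ys → y ≺ z
      y≺ z∈ with ∈-insert⁻ ys z∈
      ... | inj₁ refl = y≺x
      ... | inj₂ z∈′  = All.lookup y≺ys z∈′

    sort-sorted : ∀ xs → AllPairs Comparable xs → AllPairs _≺_ (sort xs)
    sort-sorted []       _             = []
    sort-sorted (x ∷ xs) (x~xs ∷ xs~) =
      insert-sorted x (sort xs) (All.tabulate (All.lookup x~xs ∘ ∈-sort⁻ xs)) (sort-sorted xs xs~)

∈ˢ⇒T : ∀ {n} {i : Fin n} {A} → i ∈ˢ A → T (i ∈ᵇ A)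
∈ˢ⇒T i∈ = ≡true⇒T (Vecₚ.[]=⇒lookup i∈)

T⇒∈ˢ : ∀ {n} {i : Fin n} {A} → T (i ∈ᵇ A) → i ∈ˢ A
T⇒∈ˢ {i = i} {A} t = Vecₚ.lookup⇒[]= i A (T⇒≡true t)

Disjoint : ∀ {n} → Subset n → Subset n → Set
Disjoint A B = ∀ {i} → i ∈ˢ A → ¬ i ∈ˢ B

Disjoint-sym : ∀ {n} {A B : Subset n} → Disjoint A B → Disjoint B A
Disjoint-sym A#B i∈B i∈A = A#B i∈A i∈B

disjoint⇒Disjoint : ∀ {n} {A B : Subset n} → T (disjoint A B) → Disjoint A B
disjoint⇒Disjoint t i∈A i∈B = ∉⊥ (subst (_ ∈ˢ_) (toWitness t) (x∈p∩q⁺ (i∈A , i∈B)))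

Disjoint⇒disjoint : ∀ {n} {A B : Subset n} → Disjoint A B → T (disjoint A B)
Disjoint⇒disjoint {A = A} {B} A#B =
  fromWitness (⊆-antisym (λ i∈ → let i∈A , i∈B = x∈p∩q⁻ A B i∈ in ⊥-elim (A#B i∈A i∈B))
                         (⊥-elim ∘ ∉⊥))

∈-unionAll⁺ : ∀ {n} {L : List (Subset n)} {B i} → B ∈ L → i ∈ˢ B → i ∈ˢ unionAll L
∈-unionAll⁺ (here refl) i∈ = x∈p∪q⁺ (inj₁ i∈)
∈-unionAll⁺ (there B∈)  i∈ = x∈p∪q⁺ (inj₂ (∈-unionAll⁺ B∈ i∈))

∈-unionAll⁻ : ∀ {n} (L : List (Subset n)) {i} → i ∈ˢ unionAll L → ∃ λ B → B ∈ L × i ∈ˢ B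
∈-unionAll⁻ []      i∈ = ⊥-elim (∉⊥ i∈)
∈-unionAll⁻ (C ∷ L) i∈ with x∈p∪q⁻ C (unionAll L) i∈
... | inj₁ i∈C = C , here refl , i∈C
... | inj₂ i∈L with ∈-unionAll⁻ L i∈L
...   | B , B∈ , i∈B = B , there B∈ , i∈B

∣∪∣≡∣∣+∣∣ : ∀ {n} (A B : Subset n) → Disjoint A B → ∣ A ∪ B ∣ ≡ ∣ A ∣ + ∣ B ∣
∣∪∣≡∣∣+∣∣ []          []          _   = refl
∣∪∣≡∣∣+∣∣ (true ∷ A)  (true ∷ B)  A#B = ⊥-elim (A#B here here)
∣∪∣≡∣∣+∣∣ (true ∷ A)  (false ∷ B) A#B =
  cong suc (∣∪∣≡∣∣+∣∣ A B (λ a b → A#B (there a) (there b)))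
∣∪∣≡∣∣+∣∣ (false ∷ A) (true ∷ B)  A#B =
  trans (cong suc (∣∪∣≡∣∣+∣∣ A B (λ a b → A#B (there a) (there b)))) (sym (+-suc ∣ A ∣ ∣ B ∣))
∣∪∣≡∣∣+∣∣ (false ∷ A) (false ∷ B) A#B = ∣∪∣≡∣∣+∣∣ A B (λ a b → A#B (there a) (there b))

Nonempty-tail : ∀ {n} {A : Subset n} → Nonempty (false ∷ A) → Nonempty A
Nonempty-tail (Fin.suc i , there i∈) = i , i∈

Nonempty⇒1≤∣∣ : ∀ {n} (A : Subset n) → Nonempty A → 1 ≤ ∣ A ∣
Nonempty⇒1≤∣∣ (true ∷ A)  _   = s≤s z≤n
Nonempty⇒1≤∣∣ (false ∷ A) A≠∅ = Nonempty⇒1≤∣∣ A (Nonempty-tail A≠∅)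

length≤∣unionAll∣ : ∀ {n} (L : List (Subset n)) → All Nonempty L → AllPairs Disjoint L →
  length L ≤ ∣ unionAll L ∣
length≤∣unionAll∣ []      _             _               = z≤n
length≤∣unionAll∣ (B ∷ L) (B≠∅ ∷ L≠∅) (B#L ∷ L-disj) =
  subst (suc (length L) ≤_) (sym (∣∪∣≡∣∣+∣∣ B (unionAll L) B#⋃L))
        (+-mono-≤ (Nonempty⇒1≤∣∣ B B≠∅) (length≤∣unionAll∣ L L≠∅ L-disj))
  where
  B#⋃L : Disjoint B (unionAll L)
  B#⋃L i∈B i∈L with ∈-unionAll⁻ L i∈L
  ... | C , C∈ , i∈C = All.lookup B#L C∈ i∈B i∈C

minElt-common : ∀ {n} (A B : Subset n) → Nonempty A → Nonempty B → minElt A ≡ minElt B →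
  ∃ λ i → i ∈ˢ A × i ∈ˢ B
minElt-common (true ∷ A)  (true ∷ B)  _   _   _  = Fin.zero , here , here
minElt-common (false ∷ A) (false ∷ B) A≠∅ B≠∅ eq
  with minElt-common A B (Nonempty-tail A≠∅) (Nonempty-tail B≠∅) (suc-injective eq)
... | i , i∈A , i∈B = Fin.suc i , there i∈A , there i∈B

Disjoint⇒minElt≢ : ∀ {n} {A B : Subset n} → Disjoint A B → Nonempty A → Nonempty B → minElt A ≢ minElt B
Disjoint⇒minElt≢ {A = A} {B} A#B A≠∅ B≠∅ eq with minElt-common A B A≠∅ B≠∅ eq
... | _ , i∈A , i∈B = A#B i∈A i∈B

record IsSetComposition {n} (Φ : List (Subset n)) : Set where
  field
    blocks-nonempty : All Nonempty Φ
    blocks-disjoint : AllPairs Disjoint Φ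
    blocks-cover    : ∀ i → ∃ λ B → B ∈ Φ × i ∈ˢ B

  ⋃≡full : unionAll Φ ≡ full
  ⋃≡full = ⊆-antisym (λ _ → ∈⊤) (λ {i} _ → let _ , B∈ , i∈B = blocks-cover i in ∈-unionAll⁺ B∈ i∈B)

  length≤n : length Φ ≤ n
  length≤n = ≤-trans (length≤∣unionAll∣ Φ blocks-nonempty blocks-disjoint)
                     (≤-reflexive (trans (cong ∣_∣ ⋃≡full) (∣⊤∣≡n n)))

nonempty⇒Nonempty : ∀ {n} (A : Subset n) → T (nonempty A) → Nonempty A
nonempty⇒Nonempty {n} A t with find (any⁻ (_∈ᵇ A) (allFin n) t)
... | i , _ , i∈A = i , T⇒∈ˢ i∈A

Nonempty⇒nonempty : ∀ {n} (A : Subset n) → Nonempty A → T (nonempty A)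
Nonempty⇒nonempty A (i , i∈A) = any⁺ (_∈ᵇ A) (lose (∈-allFin i) (∈ˢ⇒T i∈A))

pairwiseDisjoint⇒ : ∀ {n} (L : List (Subset n)) → T (pairwiseDisjoint L) → AllPairs Disjoint L
pairwiseDisjoint⇒ []      _ = []
pairwiseDisjoint⇒ (B ∷ L) t with ∧-elim {all (disjoint B) L} t
... | B#L , L-disj = All.map disjoint⇒Disjoint (all⁺ (disjoint B) L B#L) ∷ pairwiseDisjoint⇒ L L-disj

pairwiseDisjoint⇐ : ∀ {n} (L : List (Subset n)) → AllPairs Disjoint L → T (pairwiseDisjoint L)
pairwiseDisjoint⇐ []      _                = tt
pairwiseDisjoint⇐ (B ∷ L) (B#L ∷ L-disj) =
  ∧-intro (all⁻ (disjoint B) (All.map Disjoint⇒disjoint B#L)) (pairwiseDisjoint⇐ L L-disj)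

isSetComposition⇒ : ∀ {n} (Φ : List (Subset n)) → T (isSetComposition Φ) → IsSetComposition Φ
isSetComposition⇒ Φ t with ∧-elim {all nonempty Φ} t
... | nonempty-Φ , rest with ∧-elim {pairwiseDisjoint Φ} rest
... | disjoint-Φ , ⋃Φ≡full = record
  { blocks-nonempty = All.map (nonempty⇒Nonempty _) (all⁺ nonempty Φ nonempty-Φ)
  ; blocks-disjoint = pairwiseDisjoint⇒ Φ disjoint-Φ
  ; blocks-cover    = λ i → ∈-unionAll⁻ Φ (subst (i ∈ˢ_) (sym (toWitness ⋃Φ≡full)) ∈⊤)
  }

isSetComposition⇐ : ∀ {n} {Φ : List (Subset n)} → IsSetComposition Φ → T (isSetComposition Φ)
isSetComposition⇐ {Φ = Φ} Φ-comp =
  ∧-intro (all⁻ nonempty (All.map (Nonempty⇒nonempty _) blocks-nonempty))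
          (∧-intro (pairwiseDisjoint⇐ Φ blocks-disjoint) (fromWitness ⋃≡full))
  where open IsSetComposition Φ-comp

_<ᵐ_ : ∀ {n} → Subset n → Subset n → Set
A <ᵐ B = minElt A < minElt B

module SortByMin {n : ℕ} = InsertionSort {Subset n} (λ A B → minElt A <ᵇ minElt B)

sortBlocks≡sort : ∀ {n} (Φ : List (Subset n)) → sortBlocks Φ ≡ SortByMin.sort Φ
sortBlocks≡sort []      = refl
sortBlocks≡sort (B ∷ Φ) rewrite sortBlocks≡sort Φ = insertBlock≡insert (SortByMin.sort Φ)
  where
  insertBlock≡insert : ∀ L → insertBlock B L ≡ SortByMin.insert B L
  insertBlock≡insert []      = refl
  insertBlock≡insert (C ∷ L) rewrite insertBlock≡insert L = refl

∈-sortBlocks⁻ : ∀ {n} (Φ : List (Subset n)) {B} → B ∈ sortBlocks Φ → B ∈ Φ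
∈-sortBlocks⁻ Φ B∈ = SortByMin.∈-sort⁻ Φ (subst (_ ∈_) (sortBlocks≡sort Φ) B∈)

∈-sortBlocks⁺ : ∀ {n} (Φ : List (Subset n)) {B} → B ∈ Φ → B ∈ sortBlocks Φ
∈-sortBlocks⁺ Φ B∈ = subst (_ ∈_) (sym (sortBlocks≡sort Φ)) (SortByMin.∈-sort⁺ Φ B∈)

sortBlocks-sorted : ∀ {n} (Φ : List (Subset n)) → All Nonempty Φ → AllPairs Disjoint Φ →
  AllPairs _<ᵐ_ (sortBlocks Φ)
sortBlocks-sorted Φ Φ≠∅ Φ-disj =
  subst (AllPairs _<ᵐ_) (sym (sortBlocks≡sort Φ))
        (SortByMin.sort-sorted (<ᵇ⇒< _ _) <⇒<ᵇ <-trans Φ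
           (AllPairs-mapWith∈ Φ-disj (λ A∈ B∈ A#B →
              comparable (Disjoint⇒minElt≢ A#B (All.lookup Φ≠∅ A∈) (All.lookup Φ≠∅ B∈)))))
  where
  comparable : ∀ {a b} → a ≢ b → a < b ⊎ b < a
  comparable {a} {b} a≢b with <-cmp a b
  ... | tri< a<b _ _ = inj₁ a<b
  ... | tri≈ _ a≡b _ = ⊥-elim (a≢b a≡b)
  ... | tri> _ _ b<a = inj₂ b<a

sortBlocks-cong : ∀ {n} {Φ Ψ : List (Subset n)} → IsSetComposition Φ → IsSetComposition Ψ →
  (∀ {B} → B ∈ Φ → B ∈ Ψ) → (∀ {B} → B ∈ Ψ → B ∈ Φ) → sortBlocks Φ ≡ sortBlocks Ψ
sortBlocks-cong {Φ = Φ} {Ψ} Φ-comp Ψ-comp Φ⊆Ψ Ψ⊆Φ =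
  strictlySorted-unique (λ {A} → <-irrefl (refl {x = minElt A})) <-asym
    (sortBlocks-sorted Φ (IsSetComposition.blocks-nonempty Φ-comp) (IsSetComposition.blocks-disjoint Φ-comp))
    (sortBlocks-sorted Ψ (IsSetComposition.blocks-nonempty Ψ-comp) (IsSetComposition.blocks-disjoint Ψ-comp))
    (∈-sortBlocks⁺ Ψ ∘ Φ⊆Ψ ∘ ∈-sortBlocks⁻ Φ) (∈-sortBlocks⁺ Φ ∘ Ψ⊆Φ ∘ ∈-sortBlocks⁻ Ψ)

_>ᴰ_ : ∀ {n} → Subset n → Subset n → Set
A >ᴰ B = ∣ B ∣ < ∣ A ∣ ⊎ (∣ A ∣ ≡ ∣ B ∣ × minElt A < minElt B)

>D⇒>ᴰ : ∀ {n} {A B : Subset n} → T (A >D B) → A >ᴰ B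
>D⇒>ᴰ {A = A} {B} t with ∨-elim {∣ B ∣ <ᵇ ∣ A ∣} t
... | inj₁ ∣B∣<∣A∣ = inj₁ (<ᵇ⇒< _ _ ∣B∣<∣A∣)
... | inj₂ tie with ∧-elim {∣ A ∣ ≡ᵇ ∣ B ∣} tie
...   | ∣A∣≡∣B∣ , minA<minB = inj₂ (≡ᵇ⇒≡ _ _ ∣A∣≡∣B∣ , <ᵇ⇒< _ _ minA<minB)

>ᴰ⇒>D : ∀ {n} {A B : Subset n} → A >ᴰ B → T (A >D B)
>ᴰ⇒>D (inj₁ ∣B∣<∣A∣)                = ∨-introˡ (<⇒<ᵇ ∣B∣<∣A∣)
>ᴰ⇒>D {A = A} {B} (inj₂ (∣A∣≡∣B∣ , minA<minB)) =
  ∨-introʳ {∣ B ∣ <ᵇ ∣ A ∣} (∧-intro (≡⇒≡ᵇ _ _ ∣A∣≡∣B∣) (<⇒<ᵇ minA<minB))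

>ᴰ-irrefl : ∀ {n} {A : Subset n} → ¬ A >ᴰ A
>ᴰ-irrefl (inj₁ ∣A∣<∣A∣)     = <-irrefl refl ∣A∣<∣A∣
>ᴰ-irrefl (inj₂ (_ , min<min)) = <-irrefl refl min<min

>ᴰ-trans : ∀ {n} {A B C : Subset n} → A >ᴰ B → B >ᴰ C → A >ᴰ C
>ᴰ-trans (inj₁ b<a)       (inj₁ c<b)       = inj₁ (<-trans c<b b<a)
>ᴰ-trans (inj₁ b<a)       (inj₂ (b≡c , _)) = inj₁ (subst (_< _) b≡c b<a)
>ᴰ-trans (inj₂ (a≡b , _)) (inj₁ c<b)       = inj₁ (subst (_ <_) (sym a≡b) c<b)
>ᴰ-trans (inj₂ (a≡b , x)) (inj₂ (b≡c , y)) = inj₂ (trans a≡b b≡c , <-trans x y)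

>ᴰ-comparable : ∀ {n} (A B : Subset n) → minElt A ≢ minElt B → A >ᴰ B ⊎ B >ᴰ A
>ᴰ-comparable A B minA≢minB with <-cmp ∣ A ∣ ∣ B ∣
... | tri< ∣A∣<∣B∣ _ _ = inj₂ (inj₁ ∣A∣<∣B∣)
... | tri> _ _ ∣B∣<∣A∣ = inj₁ (inj₁ ∣B∣<∣A∣)
... | tri≈ _ ∣A∣≡∣B∣ _ with <-cmp (minElt A) (minElt B)
...   | tri< minA<minB _ _ = inj₁ (inj₂ (∣A∣≡∣B∣ , minA<minB))
...   | tri≈ _ minA≡minB _ = ⊥-elim (minA≢minB minA≡minB)
...   | tri> _ _ minB<minA = inj₂ (inj₂ (sym ∣A∣≡∣B∣ , minB<minA))

module SortByD {n : ℕ} = InsertionSort {Subset n} _>D_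

module Levels {n : ℕ} (w : Word n) where

  SameValue : Subset n → Subset n → Set
  SameValue B C = ∀ {p q} → p ∈ˢ B → q ∈ˢ C → lookup w p ≡ lookup w q

  LowerValue : Subset n → Subset n → Set
  LowerValue B C = ∀ {p q} → p ∈ˢ B → q ∈ˢ C → lookup w p < lookup w q

  Constant : Subset n → Set
  Constant B = SameValue B B

  HasValue : ℕ → Subset n → Set
  HasValue v B = Nonempty B × (∀ {p} → p ∈ˢ B → lookup w p ≡ v)

  level : ℕ → Subset n
  level v = tabulate (λ i → lookup w i ≡ᵇ v)

  ∈-level⁻ : ∀ {v p} → p ∈ˢ level v → lookup w p ≡ v
  ∈-level⁻ {v} {p} p∈ =
    ≡ᵇ⇒≡ _ _ (subst T (Vecₚ.lookup∘tabulate (λ i → lookup w i ≡ᵇ v) p) (∈ˢ⇒T p∈))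

  ∈-level⁺ : ∀ {v p} → lookup w p ≡ v → p ∈ˢ level v
  ∈-level⁺ {v} {p} wp≡v =
    T⇒∈ˢ (subst T (sym (Vecₚ.lookup∘tabulate (λ i → lookup w i ≡ᵇ v) p)) (≡⇒≡ᵇ _ _ wp≡v))

  ⊆level⇒SameValue : ∀ {v B C} → (∀ {p} → p ∈ˢ B → p ∈ˢ level v) →
    (∀ {q} → q ∈ˢ C → q ∈ˢ level v) → SameValue B C
  ⊆level⇒SameValue B⊆ C⊆ p∈B q∈C = trans (∈-level⁻ (B⊆ p∈B)) (sym (∈-level⁻ (C⊆ q∈C)))

  ∈-ϱ⁻ : ∀ {X} → X ∈ ϱ w → ∃ λ v → X ≡ level v
  ∈-ϱ⁻ X∈ with ∈-map⁻ level X∈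
  ... | v , _ , X≡ = v , X≡

  occurs? : Decidable (λ v → T (any (λ i → lookup w i ≡ᵇ v) (allFin n)))
  occurs? v = T? (any (λ i → lookup w i ≡ᵇ v) (allFin n))

  valuesOf-increasing : AllPairs _<_ (valuesOf w)
  valuesOf-increasing = AllPairsₚ.filter⁺ occurs? (AllPairsₚ.applyUpTo⁺₁ id _ (λ i<j _ → i<j))

  ϱ-increasing : AllPairs LowerValue (ϱ w)
  ϱ-increasing = AllPairsₚ.map⁺ (AllPairs.map (λ {u} {v} u<v {p} {q} p∈ q∈ →
    subst₂ _<_ (sym (∈-level⁻ p∈)) (sym (∈-level⁻ q∈)) u<v) valuesOf-increasing)

  ∈-valuesOf⁺ : ∀ p → lookup w p ∈ valuesOf w
  ∈-valuesOf⁺ p = ∈-filter⁺ occurs? (∈-upTo⁺ (s≤s (≤max w p)))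
                   (any⁺ (λ i → lookup w i ≡ᵇ lookup w p) (lose (∈-allFin p) (≡⇒≡ᵇ (lookup w p) _ refl)))
    where
    ≤max : ∀ {m} (u : Vec ℕ m) p → lookup u p ≤ foldr _⊔_ 0 (toList u)
    ≤max (x ∷ u) Fin.zero    = m≤m⊔n x _
    ≤max (x ∷ u) (Fin.suc p) = ≤-trans (≤max u p) (m≤n⊔m x _)

  ∈-valuesOf⁻ : ∀ {v} → v ∈ valuesOf w → ∃ λ p → lookup w p ≡ v
  ∈-valuesOf⁻ {v} v∈ with find (any⁻ _ (allFin n) (proj₂ (∈-filter⁻ occurs? v∈)))
  ... | p , _ , wp≡v = p , ≡ᵇ⇒≡ _ _ wp≡v

  constantOnBlocks⇒ : ∀ φ → T (constantOnBlocks φ w) → All Constant φ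
  constantOnBlocks⇒ φ t = All.map (λ {B} → constant B) (all⁺ _ φ t)
    where
    constant : ∀ B →
      T (all (λ j → all (λ k → not (j ∈ᵇ B ∧ k ∈ᵇ B) ∨ (lookup w j ≡ᵇ lookup w k)) (allFin n)) (allFin n)) →
      Constant B
    constant B t {p} {q} p∈ q∈
      with ∨-elim {not (p ∈ᵇ B ∧ q ∈ᵇ B)}
             (All.lookup (all⁺ _ (allFin n) (All.lookup (all⁺ _ (allFin n) t) (∈-allFin p))) (∈-allFin q))
    ... | inj₁ not-both = ⊥-elim (subst T (Equivalence.to T-not-≡ not-both) (∧-intro (∈ˢ⇒T p∈) (∈ˢ⇒T q∈)))
    ... | inj₂ wp≡wq    = ≡ᵇ⇒≡ _ _ wp≡wq

  constantOnBlocks⇐ : ∀ φ → All Constant φ → T (constantOnBlocks φ w)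
  constantOnBlocks⇐ φ φ-const = all⁻ _ (All.map (λ {B} → block B) φ-const)
    where
    pair : ∀ B → Constant B → ∀ j k → T (not (j ∈ᵇ B ∧ k ∈ᵇ B) ∨ (lookup w j ≡ᵇ lookup w k))
    pair B B-const j k with j ∈ᵇ B in j∈ | k ∈ᵇ B in k∈
    ... | true  | true  = ≡⇒≡ᵇ _ _ (B-const (T⇒∈ˢ (≡true⇒T j∈)) (T⇒∈ˢ (≡true⇒T k∈)))
    ... | true  | false = tt
    ... | false | _     = tt
    block : ∀ B → Constant B →
      T (all (λ j → all (λ k → not (j ∈ᵇ B ∧ k ∈ᵇ B) ∨ (lookup w j ≡ᵇ lookup w k)) (allFin n)) (allFin n))
    block B B-const =
      all⁻ _ {allFin n} (All.tabulate (λ {j} _ → all⁻ _ {allFin n} (All.tabulate (λ {k} _ → pair B B-const j k))))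

columnUnion : ∀ {n} → List (Subset n) → List ℕ → ℕ → Subset n
columnUnion Φ cs c = unionAll (inColumn Φ cs c)

-- colReading selects the nonempty columns by a predicate local to its where-block;
-- this record recovers that predicate by unification.
record ColumnReading {n} (Φ : List (Subset n)) (cs : List ℕ) : Set₁ where
  field
    Kept    : ℕ → Set
    kept?   : Decidable Kept
    reading : colReading Φ cs ≡ map (columnUnion Φ cs) (filter kept? (map suc (upTo (foldr _⊔_ 0 cs))))

columnReading : ∀ {n} (Φ : List (Subset n)) cs → ColumnReading Φ cs
columnReading Φ cs = record { Kept = _ ; kept? = _ ; reading = refl }

nonemptyColumns : ∀ {n} → List (Subset n) → List ℕ → List ℕ
nonemptyColumns Φ cs = filter (ColumnReading.kept? (columnReading Φ cs)) (map suc (upTo (foldr _⊔_ 0 cs)))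

∈-inColumn⇒Kept : ∀ {n} (Φ : List (Subset n)) cs {c X} → X ∈ inColumn Φ cs c →
  ColumnReading.Kept (columnReading Φ cs) c
∈-inColumn⇒Kept Φ cs {c} X∈ with inColumn Φ cs c | X∈
... | _ ∷ _ | _ = tt

∈-inColumn-head : ∀ {n} (A : Subset n) As c ds → A ∈ inColumn (A ∷ As) (c ∷ ds) c
∈-inColumn-head A As c ds rewrite ≡ᵇ-refl c = here refl

∈-inColumn-tail : ∀ {n} (A : Subset n) As d ds {c X} → X ∈ inColumn As ds c → X ∈ inColumn (A ∷ As) (d ∷ ds) c
∈-inColumn-tail A As d ds {c} X∈ with d ≡ᵇ c
... | true  = there X∈
... | false = X∈

∈-inColumn⇒∈columns : ∀ {n} (As : List (Subset n)) ds {c X} → X ∈ inColumn As ds c → c ∈ ds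
∈-inColumn⇒∈columns (A ∷ As) (d ∷ ds) {c} X∈ with d ≡ᵇ c in d≡c
... | true  = here (sym (≡ᵇ⇒≡ d c (≡true⇒T d≡c)))
... | false = there (∈-inColumn⇒∈columns As ds X∈)

∈-nonemptyColumns : ∀ {n} (Φ : List (Subset n)) cs {c X} → X ∈ inColumn Φ cs c → 1 ≤ c →
  c ∈ nonemptyColumns Φ cs
∈-nonemptyColumns Φ cs {suc c} X∈ _ =
  ∈-filter⁺ (ColumnReading.kept? (columnReading Φ cs))
            (∈-map⁺ suc (∈-upTo⁺ (≤max (∈-inColumn⇒∈columns Φ cs X∈))))
            (∈-inColumn⇒Kept Φ cs X∈)
  where
  ≤max : ∀ {ds} → suc c ∈ ds → suc c ≤ foldr _⊔_ 0 ds
  ≤max {d ∷ ds} (here refl) = m≤m⊔n d (foldr _⊔_ 0 ds)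
  ≤max {d ∷ ds} (there c∈)  = ≤-trans (≤max c∈) (m≤n⊔m d _)

nonemptyColumns-increasing : ∀ {n} (Φ : List (Subset n)) cs → AllPairs _<_ (nonemptyColumns Φ cs)
nonemptyColumns-increasing Φ cs =
  AllPairsₚ.filter⁺ (ColumnReading.kept? (columnReading Φ cs))
    (AllPairsₚ.map⁺ (AllPairs.map s≤s (AllPairsₚ.applyUpTo⁺₁ id (foldr _⊔_ 0 cs) (λ i<j _ → i<j))))

columnsOf : {A : Set} → ℕ → List (List A) → List ℕ
columnsOf s []       = []
columnsOf s (G ∷ Gs) = map (λ _ → s) G ++ columnsOf (suc s) Gs

length-columnsOf : {A : Set} (s : ℕ) (Gs : List (List A)) → length (columnsOf s Gs) ≡ length (concat Gs)
length-columnsOf s []       = refl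
length-columnsOf s (G ∷ Gs) =
  trans (length-++ (map (λ _ → s) G))
        (trans (cong₂ _+_ (length-map (λ _ → s) G) (length-columnsOf (suc s) Gs)) (sym (length-++ G)))

columnsOf-bounds : {A : Set} (s : ℕ) (Gs : List (List A)) {c : ℕ} → c ∈ columnsOf s Gs → s ≤ c × c < s + length Gs
columnsOf-bounds s (G ∷ Gs) c∈ with ∈-++⁻ (map (λ _ → s) G) c∈
... | inj₁ c∈G with ∈-map⁻ (λ _ → s) c∈G
...   | _ , _ , refl = ≤-refl , m<m+n s (s≤s z≤n)
columnsOf-bounds s (G ∷ Gs) {c} c∈ | inj₂ c∈Gs with columnsOf-bounds (suc s) Gs c∈Gs
... | s<c , c<1+s+∣Gs∣ = <⇒≤ s<c , subst (c <_) (sym (+-suc s (length Gs))) c<1+s+∣Gs∣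

length≤length-concat : {A : Set} (Gs : List (List A)) → All NonEmptyList Gs → length Gs ≤ length (concat Gs)
length≤length-concat []             _             = z≤n
length≤length-concat ((_ ∷ G) ∷ Gs) (_ ∷ Gs≠[]) =
  s≤s (≤-trans (length≤length-concat Gs Gs≠[]) (subst (_ ≤_) (sym (length-++ G)) (m≤n+m _ _)))

inColumn-++ : ∀ {n} (G R : List (Subset n)) Rc s c →
  inColumn (G ++ R) (map (λ _ → s) G ++ Rc) c ≡ (if s ≡ᵇ c then G else []) ++ inColumn R Rc c
inColumn-++ []      R Rc s c with s ≡ᵇ c
... | true  = refl
... | false = refl
inColumn-++ (B ∷ G) R Rc s c with s ≡ᵇ c in s≡c
... | true  = cong (B ∷_) (trans (inColumn-++ G R Rc s c) (cong (λ b → (if b then G else []) ++ inColumn R Rc c) s≡c))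
... | false = trans (inColumn-++ G R Rc s c) (cong (λ b → (if b then G else []) ++ inColumn R Rc c) s≡c)

inColumn-absent : ∀ {n} (R : List (Subset n)) Rc c → (∀ {d} → d ∈ Rc → d ≢ c) → inColumn R Rc c ≡ []
inColumn-absent []      Rc       c _     = refl
inColumn-absent (B ∷ R) []       c _     = refl
inColumn-absent (B ∷ R) (d ∷ Rc) c d≢c with d ≡ᵇ c in d≡c
... | true  = ⊥-elim (d≢c (here refl) (≡ᵇ⇒≡ d c (≡true⇒T d≡c)))
... | false = inColumn-absent R Rc c (d≢c ∘ there)

inColumn-columnsOf : ∀ {n} (Gs : List (List (Subset n))) s →
  map (inColumn (concat Gs) (columnsOf s Gs)) (range s (length Gs)) ≡ Gs
inColumn-columnsOf []       s = refl
inColumn-columnsOf (G ∷ Gs) s = cong₂ _∷_ first rest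
  where
  open ≡-Reasoning
  Rc : List ℕ
  Rc = columnsOf (suc s) Gs
  first : inColumn (G ++ concat Gs) (map (λ _ → s) G ++ Rc) s ≡ G
  first = begin
    inColumn (G ++ concat Gs) (map (λ _ → s) G ++ Rc) s  ≡⟨ inColumn-++ G (concat Gs) Rc s s ⟩
    (if s ≡ᵇ s then G else []) ++ inColumn (concat Gs) Rc s
      ≡⟨ cong₂ (λ b X → (if b then G else []) ++ X) (≡ᵇ-refl s)
               (inColumn-absent (concat Gs) Rc s
                  (λ d∈ d≡s → <-irrefl (sym d≡s) (proj₁ (columnsOf-bounds (suc s) Gs d∈)))) ⟩
    G ++ []  ≡⟨ ++-identityʳ G ⟩
    G ∎
  later : ∀ {c} → c ∈ range (suc s) (length Gs) →
    inColumn (G ++ concat Gs) (map (λ _ → s) G ++ Rc) c ≡ inColumn (concat Gs) Rc c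
  later {c} c∈ = trans (inColumn-++ G (concat Gs) Rc s c)
    (cong (λ b → (if b then G else []) ++ inColumn (concat Gs) Rc c)
          (¬T⇒≡false (λ s≡c → <-irrefl (≡ᵇ⇒≡ s c s≡c) (proj₁ (∈-range⁻ c∈)))))
  rest : map (inColumn (G ++ concat Gs) (map (λ _ → s) G ++ Rc)) (range (suc s) (length Gs)) ≡ Gs
  rest = trans (map-cong-local (All.tabulate later)) (inColumn-columnsOf Gs (suc s))
  
max-columnsOf : {A : Set} (s : ℕ) (Gs : List (List A)) → All NonEmptyList Gs →
  foldr _⊔_ 0 (columnsOf (suc s) Gs) ⊔ s ≡ s + length Gs
max-columnsOf s []       _             = trans (⊔-identityˡ s) (sym (+-identityʳ s))
max-columnsOf s (G ∷ Gs) (G≠[] ∷ Gs≠[]) = begin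
  foldr _⊔_ 0 (map (λ _ → suc s) G ++ columnsOf (suc (suc s)) Gs) ⊔ s
    ≡⟨ cong (_⊔ s) (foldr-++ _⊔_ 0 (map (λ _ → suc s) G) _) ⟩
  foldr _⊔_ M (map (λ _ → suc s) G) ⊔ s   ≡⟨ cong (_⊔ s) (max-const G G≠[]) ⟩
  (suc s ⊔ M) ⊔ s                          ≡⟨ m≥n⇒m⊔n≡m (≤-trans (n≤1+n s) (m≤m⊔n (suc s) M)) ⟩
  suc s ⊔ M                                ≡⟨ ⊔-comm (suc s) M ⟩
  M ⊔ suc s                                ≡⟨ max-columnsOf (suc s) Gs Gs≠[] ⟩
  suc s + length Gs                        ≡⟨ sym (+-suc s (length Gs)) ⟩
  s + suc (length Gs)                      ∎
  where
  open ≡-Reasoning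
  M : ℕ
  M = foldr _⊔_ 0 (columnsOf (suc (suc s)) Gs)
  max-const : ∀ G → NonEmptyList G → foldr _⊔_ M (map (λ _ → suc s) G) ≡ suc s ⊔ M
  max-const (_ ∷ [])    _ = refl
  max-const (_ ∷ x ∷ G) _ =
    trans (cong (suc s ⊔_) (max-const (x ∷ G) tt))
          (trans (sym (⊔-assoc (suc s) (suc s) M)) (cong (_⊔ M) (⊔-idem (suc s))))

colReading-columnsOf : ∀ {n} (Gs : List (List (Subset n))) → All NonEmptyList Gs →
  colReading (concat Gs) (columnsOf 1 Gs) ≡ map unionAll Gs
colReading-columnsOf Gs Gs≠[] = begin
  map (columnUnion Φ cs) (filter kept? (map suc (upTo (foldr _⊔_ 0 cs))))
    ≡⟨ cong (λ m → map (columnUnion Φ cs) (filter kept? (map suc (upTo m))))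
            (trans (sym (⊔-identityʳ _)) (max-columnsOf 0 Gs Gs≠[])) ⟩
  map (columnUnion Φ cs) (filter kept? (map suc (upTo L)))
    ≡⟨ cong (λ cols → map (columnUnion Φ cs) (filter kept? cols)) (range≡map-suc-upTo L) ⟩
  map (columnUnion Φ cs) (filter kept? (range 1 L))
    ≡⟨ cong (map (columnUnion Φ cs)) (filter-all kept? (All.tabulate all-kept)) ⟩
  map (columnUnion Φ cs) (range 1 L)                  ≡⟨ map-∘ (range 1 L) ⟩
  map unionAll (map (inColumn Φ cs) (range 1 L))      ≡⟨ cong (map unionAll) (inColumn-columnsOf Gs 1) ⟩
  map unionAll Gs                                     ∎
  where
  open ≡-Reasoning
  Φ : List (Subset _)
  Φ = concat Gs
  cs : List ℕ
  cs = columnsOf 1 Gs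
  L : ℕ
  L = length Gs
  open ColumnReading (columnReading Φ cs)
  all-kept : ∀ {c} → c ∈ range 1 L → Kept c
  all-kept {c} c∈ = kept (inColumn Φ cs c) refl
    (All.lookup Gs≠[] (subst (inColumn Φ cs c ∈_) (inColumn-columnsOf Gs 1) (∈-map⁺ (inColumn Φ cs) c∈)))
    where
    kept : ∀ G → inColumn Φ cs c ≡ G → NonEmptyList G → Kept c
    kept (X ∷ _) col≡ _ = ∈-inColumn⇒Kept Φ cs (subst (X ∈_) (sym col≡) (here refl))

valueAtMin : ∀ {n} → Subset n → Vec ℕ n → ℕ
valueAtMin []          []      = 0
valueAtMin (true ∷ A)  (x ∷ u) = x
valueAtMin (false ∷ A) (x ∷ u) = valueAtMin A u

valueAtMin-attained : ∀ {n} (A : Subset n) (u : Vec ℕ n) → Nonempty A →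
  ∃ λ i → i ∈ˢ A × lookup u i ≡ valueAtMin A u
valueAtMin-attained (true ∷ A)  (x ∷ u) _   = Fin.zero , here , refl
valueAtMin-attained (false ∷ A) (x ∷ u) A≠∅ with valueAtMin-attained A u (Nonempty-tail A≠∅)
... | i , i∈A , ui≡ = Fin.suc i , there i∈A , ui≡

module Fillings {n : ℕ} (w : Word n) where
  open Levels w

  RowBefore : Subset n → Subset n → Set
  RowBefore B C = Nonempty B × Nonempty C × (LowerValue B C ⊎ (SameValue B C × B >ᴰ C))

  RowBefore-trans : ∀ {A B C : Subset n} → RowBefore A B → RowBefore B C → RowBefore A C
  RowBefore-trans {A} {B} {C} (A≠∅ , (q , q∈B) , AB) (_ , C≠∅ , BC) = A≠∅ , C≠∅ , compose AB BC
    where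
    compose : LowerValue A B ⊎ (SameValue A B × A >ᴰ B) → LowerValue B C ⊎ (SameValue B C × B >ᴰ C) →
              LowerValue A C ⊎ (SameValue A C × A >ᴰ C)
    compose (inj₁ A<B)          (inj₁ B<C)          = inj₁ (λ p∈ r∈ → <-trans (A<B p∈ q∈B) (B<C q∈B r∈))
    compose (inj₁ A<B)          (inj₂ (B≈C , _))    =
      inj₁ (λ p∈ r∈ → subst (_ <_) (B≈C q∈B r∈) (A<B p∈ q∈B))
    compose (inj₂ (A≈B , _))    (inj₁ B<C)          =
      inj₁ (λ p∈ r∈ → subst (_< _) (sym (A≈B p∈ q∈B)) (B<C q∈B r∈))
    compose (inj₂ (A≈B , A>B)) (inj₂ (B≈C , B>C)) =
      inj₂ ((λ p∈ r∈ → trans (A≈B p∈ q∈B) (B≈C q∈B r∈)) , >ᴰ-trans A>B B>C)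

  RowBefore-irrefl : ∀ {B} → ¬ RowBefore B B
  RowBefore-irrefl ((p , p∈) , _ , inj₁ B<B)       = <-irrefl refl (B<B p∈ p∈)
  RowBefore-irrefl (_        , _ , inj₂ (_ , B>B)) = >ᴰ-irrefl B>B

  RowBefore-asym : ∀ {B C} → RowBefore B C → ¬ RowBefore C B
  RowBefore-asym BC CB = RowBefore-irrefl (RowBefore-trans BC CB)

  ColumnStep : Subset n → Subset n → ℕ → ℕ → Set
  ColumnStep B C c d = (d ≡ c × SameValue B C × B >ᴰ C) ⊎ (d ≡ suc c × LowerValue B C)

  data Chain : List (Subset n) → List ℕ → Set where
    []  : Chain [] []
    [-] : ∀ {B c} → Chain (B ∷ []) (c ∷ [])
    _∷_ : ∀ {B C c d Bs ds} → ColumnStep B C c d → Chain (C ∷ Bs) (d ∷ ds) → Chain (B ∷ C ∷ Bs) (c ∷ d ∷ ds)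

  chain⇒sorted : ∀ {Φ cs} → Chain Φ cs → All Nonempty Φ → AllPairs RowBefore Φ
  chain⇒sorted chain Φ≠∅ = Linked⇒AllPairs RowBefore-trans (linked chain Φ≠∅)
    where
    linked : ∀ {Φ cs} → Chain Φ cs → All Nonempty Φ → Linked RowBefore Φ
    linked []                                 _                    = []
    linked [-]                                _                    = [-]
    linked (inj₁ (_ , B≈C , B>C) ∷ chain) (B≠∅ ∷ C≠∅ ∷ Φ≠∅) =
      (B≠∅ , C≠∅ , inj₂ (B≈C , B>C)) ∷ linked chain (C≠∅ ∷ Φ≠∅)
    linked (inj₂ (_ , B<C) ∷ chain)       (B≠∅ ∷ C≠∅ ∷ Φ≠∅) =
      (B≠∅ , C≠∅ , inj₁ B<C) ∷ linked chain (C≠∅ ∷ Φ≠∅)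

  SameValue⇒¬LowerValue : ∀ {B C} → Nonempty B → Nonempty C → SameValue B C → ¬ LowerValue B C
  SameValue⇒¬LowerValue (p , p∈) (q , q∈) B≈C B<C = <-irrefl (B≈C p∈ q∈) (B<C p∈ q∈)

  chain-unique : ∀ {Φ c ds ds′} → Chain Φ (c ∷ ds) → Chain Φ (c ∷ ds′) → All Nonempty Φ → ds ≡ ds′
  chain-unique [-] [-] _ = refl
  chain-unique (step ∷ chain) (step′ ∷ chain′) (B≠∅ ∷ Φ≠∅) with step | step′
  ... | inj₁ (refl , _)    | inj₁ (refl , _)    = cong (_ ∷_) (chain-unique chain chain′ Φ≠∅)
  ... | inj₂ (refl , _)    | inj₂ (refl , _)    = cong (_ ∷_) (chain-unique chain chain′ Φ≠∅)
  ... | inj₁ (_ , B≈C , _) | inj₂ (_ , B<C)     = ⊥-elim (SameValue⇒¬LowerValue B≠∅ (All.head Φ≠∅) B≈C B<C)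
  ... | inj₂ (_ , B<C)     | inj₁ (_ , B≈C , _) = ⊥-elim (SameValue⇒¬LowerValue B≠∅ (All.head Φ≠∅) B≈C B<C)

  chain⇒lddSteps : ∀ {Φ cs} → Chain Φ cs → T (lddSteps Φ cs)
  chain⇒lddSteps []  = tt
  chain⇒lddSteps [-] = tt
  chain⇒lddSteps {B ∷ C ∷ _} {c ∷ _} (inj₁ (refl , _ , B>C) ∷ chain) rewrite T⇒≡true (>ᴰ⇒>D B>C) =
    ∧-intro (∨-introˡ (≡⇒≡ᵇ c c refl)) (chain⇒lddSteps chain)
  chain⇒lddSteps {B ∷ C ∷ _} {c ∷ _} (inj₂ (refl , _) ∷ chain) with B >D C
  ... | true  = ∧-intro (∨-introʳ {suc c ≡ᵇ c} (≡⇒≡ᵇ c c refl)) (chain⇒lddSteps chain)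
  ... | false = ∧-intro (≡⇒≡ᵇ c c refl) (chain⇒lddSteps chain)

  LDDStep : Subset n → Subset n → ℕ → ℕ → Bool
  LDDStep A B c d = if A >D B then (d ≡ᵇ c) ∨ (d ≡ᵇ suc c) else (d ≡ᵇ suc c)

  lddStep-cases : ∀ {A B c d} → T (LDDStep A B c d) → (d ≡ c × T (A >D B)) ⊎ d ≡ suc c
  lddStep-cases {A} {B} {c} {d} t with A >D B
  ... | false = inj₂ (≡ᵇ⇒≡ d (suc c) t)
  ... | true with ∨-elim {d ≡ᵇ c} t
  ...   | inj₁ d≡c   = inj₁ (≡ᵇ⇒≡ d c d≡c , tt)
  ...   | inj₂ d≡1+c = inj₂ (≡ᵇ⇒≡ d (suc c) d≡1+c)

  Contributes : List (Subset n) → List ℕ → Set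
  Contributes Φ cs = T (isLDD Φ cs) × colReading Φ cs ≡ ϱ w

  module _ {Φ cs} (reading : colReading Φ cs ≡ ϱ w) where

    columnUnion∈ϱ : ∀ {c X} → X ∈ inColumn Φ cs c → 1 ≤ c → columnUnion Φ cs c ∈ ϱ w
    columnUnion∈ϱ X∈ 1≤c = subst (_ ∈_) reading (∈-map⁺ (columnUnion Φ cs) (∈-nonemptyColumns Φ cs X∈ 1≤c))

    sameColumn⇒SameValue : ∀ {c X Y} → X ∈ inColumn Φ cs c → Y ∈ inColumn Φ cs c → 1 ≤ c → SameValue X Y
    sameColumn⇒SameValue X∈ Y∈ 1≤c with ∈-ϱ⁻ (columnUnion∈ϱ X∈ 1≤c)
    ... | v , U≡level = ⊆level⇒SameValue (λ p∈ → subst (_ ∈ˢ_) U≡level (∈-unionAll⁺ X∈ p∈))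
                                         (λ q∈ → subst (_ ∈ˢ_) U≡level (∈-unionAll⁺ Y∈ q∈))

    nextColumn⇒LowerValue : ∀ {c X Y} → X ∈ inColumn Φ cs c → Y ∈ inColumn Φ cs (suc c) → 1 ≤ c →
      LowerValue X Y
    nextColumn⇒LowerValue {c} X∈ Y∈ 1≤c p∈ q∈ =
      unions-increasing (∈-unionAll⁺ X∈ p∈) (∈-unionAll⁺ Y∈ q∈)
      where
      -- colReading lists the column unions by increasing column, ϱ w the level sets by increasing value.
      unions-increasing : LowerValue (columnUnion Φ cs c) (columnUnion Φ cs (suc c))
      unions-increasing =
        AllPairs-along (<-irrefl refl) <-asym
          (AllPairsₚ.map⁻ (subst (AllPairs LowerValue) (sym reading) ϱ-increasing))
          (nonemptyColumns-increasing Φ cs)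
          (∈-nonemptyColumns Φ cs X∈ 1≤c) (∈-nonemptyColumns Φ cs Y∈ (s≤s z≤n)) ≤-refl

    suffix⇒chain : ∀ A As d ds → 1 ≤ d → T (lddSteps (A ∷ As) (d ∷ ds)) →
      (∀ {c X} → X ∈ inColumn (A ∷ As) (d ∷ ds) c → X ∈ inColumn Φ cs c) →
      Chain (A ∷ As) (d ∷ ds) × All Constant (A ∷ As)
    suffix⇒chain A []       d []       1≤d _ rows = [-] , sameColumn⇒SameValue A∈ A∈ 1≤d ∷ []
      where
      A∈ : A ∈ inColumn Φ cs d
      A∈ = rows (∈-inColumn-head A [] d [])
    suffix⇒chain A (B ∷ Bs) d (e ∷ es) 1≤d t rows with ∧-elim {LDDStep A B d e} t
    ... | step , steps
      with suffix⇒chain B Bs e es (positive (lddStep-cases {A} {B} {d} {e} step)) steps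
                        (rows ∘ ∈-inColumn-tail A (B ∷ Bs) d (e ∷ es))
      where
      positive : (e ≡ d × T (A >D B)) ⊎ e ≡ suc d → 1 ≤ e
      positive (inj₁ (e≡d , _)) = subst (1 ≤_) (sym e≡d) 1≤d
      positive (inj₂ e≡1+d)     = subst (1 ≤_) (sym e≡1+d) (s≤s z≤n)
    ... | chain , constant =
      columnStep (lddStep-cases {A} {B} {d} {e} step) ∷ chain , sameColumn⇒SameValue A∈ A∈ 1≤d ∷ constant
      where
      A∈ : A ∈ inColumn Φ cs d
      A∈ = rows (∈-inColumn-head A (B ∷ Bs) d (e ∷ es))
      B∈ : B ∈ inColumn Φ cs e
      B∈ = rows (∈-inColumn-tail A (B ∷ Bs) d (e ∷ es) (∈-inColumn-head B Bs e es))
      columnStep : (e ≡ d × T (A >D B)) ⊎ e ≡ suc d → ColumnStep A B d e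
      columnStep (inj₁ (e≡d , A>B)) =
        inj₁ (e≡d , sameColumn⇒SameValue A∈ (subst (λ k → B ∈ inColumn Φ cs k) e≡d B∈) 1≤d , >D⇒>ᴰ A>B)
      columnStep (inj₂ e≡1+d) =
        inj₂ (e≡1+d , nextColumn⇒LowerValue A∈ (subst (λ k → B ∈ inColumn Φ cs k) e≡1+d B∈) 1≤d)
    suffix⇒chain A []       d (_ ∷ _) _ () _
    suffix⇒chain A (_ ∷ _)  d []      _ () _

  contributes⇒chain : ∀ {Φ cs} → Contributes Φ cs → Chain Φ cs × All Constant Φ
  contributes⇒chain {[]}     {[]}     _ = [] , []
  contributes⇒chain {B ∷ Bs} {c ∷ cs} (ldd , reading) with ∧-elim {c ≡ᵇ 1} ldd
  ... | c≡1 , steps =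
    suffix⇒chain {B ∷ Bs} {c ∷ cs} reading B Bs c cs (≤-reflexive (sym (≡ᵇ⇒≡ c 1 c≡1))) steps id
  contributes⇒chain {[]}     {_ ∷ _} (() , _)
  contributes⇒chain {_ ∷ _}  {[]}    (() , _)

  isLDD-head : ∀ {B : Subset n} {Bs c cs} → T (isLDD (B ∷ Bs) (c ∷ cs)) → c ≡ 1
  isLDD-head {c = c} t = ≡ᵇ⇒≡ c 1 (proj₁ (∧-elim {c ≡ᵇ 1} t))

  filling-unique : ∀ {Φ cs ds} → All Nonempty Φ → Contributes Φ cs → Contributes Φ ds → cs ≡ ds
  filling-unique {[]}    {[]}    {[]}    _   _   _   = refl
  filling-unique {B ∷ Bs} {c ∷ cs} {d ∷ ds} Φ≠∅ Φcs Φds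
    with isLDD-head {B} {Bs} {c} {cs} (proj₁ Φcs) | isLDD-head {B} {Bs} {d} {ds} (proj₁ Φds)
  ... | refl | refl = cong (1 ∷_) (chain-unique {c = 1} (proj₁ (contributes⇒chain {B ∷ Bs} {1 ∷ cs} Φcs))
                                                       (proj₁ (contributes⇒chain {B ∷ Bs} {1 ∷ ds} Φds)) Φ≠∅)
  filling-unique {[]}    {[]}    {_ ∷ _} _ _ (() , _)
  filling-unique {[]}    {_ ∷ _} _ (() , _) _
  filling-unique {_ ∷ _} {[]}    _ (() , _) _
  filling-unique {_ ∷ _} {_ ∷ _} {[]} _ _ (() , _)

  contribution-unique : ∀ {Φ Ψ cs ds} → All Nonempty Φ → All Nonempty Ψ →
    (∀ {B} → B ∈ Φ → B ∈ Ψ) → (∀ {B} → B ∈ Ψ → B ∈ Φ) → Contributes Φ cs → Contributes Ψ ds →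
    Φ ≡ Ψ × cs ≡ ds
  contribution-unique Φ≠∅ Ψ≠∅ Φ⊆Ψ Ψ⊆Φ Φcs Ψds
    with strictlySorted-unique RowBefore-irrefl RowBefore-asym
           (chain⇒sorted (proj₁ (contributes⇒chain Φcs)) Φ≠∅)
           (chain⇒sorted (proj₁ (contributes⇒chain Ψds)) Ψ≠∅) Φ⊆Ψ Ψ⊆Φ
  ... | refl = refl , filling-unique Φ≠∅ Φcs Ψds

  ValueGroup : ℕ → List (Subset n) → Set
  ValueGroup v G = NonEmptyList G × AllPairs _>ᴰ_ G × All (HasValue v) G

  StartsAbove : ℕ → ℕ → List (Subset n) → List ℕ → Set
  StartsAbove s v []      []      = ⊤
  StartsAbove s v (C ∷ _) (d ∷ _) = d ≡ suc s × (∀ {q} → q ∈ˢ C → v < lookup w q)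
  StartsAbove s v _       _       = ⊥

  chain-++ : ∀ {v} G {rest rcs} s → ValueGroup v G → Chain rest rcs → StartsAbove s v rest rcs →
    Chain (G ++ rest) (map (λ _ → s) G ++ rcs)
  chain-++ (B ∷ [])     {[]}    {[]}    s _ _ _ = [-]
  chain-++ (B ∷ [])     {C ∷ _} {d ∷ _} s (_ , _ , (_ , B-val) ∷ []) chain (refl , above) =
    inj₂ (refl , λ p∈ q∈ → subst (_< _) (sym (B-val p∈)) (above q∈)) ∷ chain
  chain-++ (B ∷ B′ ∷ G) s (_ , (B>G ∷ G-sorted) , (_ , B-val) ∷ G-val) chain above =
    inj₁ (refl , (λ p∈ q∈ → trans (B-val p∈) (sym (proj₂ (All.head G-val) q∈))) , All.head B>G)
    ∷ chain-++ (B′ ∷ G) s (tt , G-sorted , G-val) chain above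
  chain-++ (B ∷ [])     {[]}    {_ ∷ _} s _ _ ()
  chain-++ (B ∷ [])     {_ ∷ _} {[]}    s _ _ ()

  chain-columnsOf : ∀ (groupOf : ℕ → List (Subset n)) s {vs} → AllPairs _<_ vs →
    All (λ v → ValueGroup v (groupOf v)) vs →
    Chain (concat (map groupOf vs)) (columnsOf s (map groupOf vs))
  chain-columnsOf groupOf s {[]}     _                   _                        = []
  chain-columnsOf groupOf s {v ∷ vs} (v<vs ∷ vs-increasing) (v-group ∷ vs-groups) =
    chain-++ (groupOf v) s v-group (chain-columnsOf groupOf (suc s) vs-increasing vs-groups) (above v<vs vs-groups)
    where
    startsAbove : ∀ {u} G {R Rc} → ValueGroup u G → v < u → StartsAbove s v (G ++ R) (map (λ _ → suc s) G ++ Rc)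
    startsAbove (C ∷ G) (_ , _ , (_ , C-val) ∷ _) v<u = refl , λ q∈ → subst (v <_) (sym (C-val q∈)) v<u
    above : ∀ {us} → All (v <_) us → All (λ u → ValueGroup u (groupOf u)) us →
      StartsAbove s v (concat (map groupOf us)) (columnsOf (suc s) (map groupOf us))
    above {[]}    _             _             = tt
    above {u ∷ _} (v<u ∷ _) (u-group ∷ _) = startsAbove (groupOf u) u-group v<u

  chain⇒isLDD-columnsOf : ∀ Gs → All NonEmptyList Gs → Chain (concat Gs) (columnsOf 1 Gs) →
    T (isLDD (concat Gs) (columnsOf 1 Gs))
  chain⇒isLDD-columnsOf []             _ _     = tt
  chain⇒isLDD-columnsOf ((_ ∷ _) ∷ _)  _ chain = chain⇒lddSteps chain
  chain⇒isLDD-columnsOf ([] ∷ _)       (() ∷ _) _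

module Canonical {n : ℕ} (w : Word n) (φ : List (Subset n)) (φ-composition : IsSetComposition φ)
                 (φ-constant : All (Levels.Constant w) φ) where
  open Levels w
  open Fillings w
  open IsSetComposition φ-composition

  valueOf : Subset n → ℕ
  valueOf B = valueAtMin B w

  hasValue : ∀ {B} → B ∈ φ → HasValue (valueOf B) B
  hasValue {B} B∈ with valueAtMin-attained B w (All.lookup blocks-nonempty B∈)
  ... | q , q∈ , wq≡ = All.lookup blocks-nonempty B∈ , λ p∈ → trans (All.lookup φ-constant B∈ p∈ q∈) wq≡

  valued? : ∀ v → Decidable (λ B → T (valueOf B ≡ᵇ v))
  valued? v B = T? (valueOf B ≡ᵇ v)

  valueGroup : ℕ → List (Subset n)
  valueGroup v = SortByD.sort (filter (valued? v) φ)

  valueGroups : List (List (Subset n))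
  valueGroups = map valueGroup (valuesOf w)

  Φ₀ : List (Subset n)
  Φ₀ = concat valueGroups

  cs₀ : List ℕ
  cs₀ = columnsOf 1 valueGroups

  ∈-valueGroup⁻ : ∀ {v B} → B ∈ valueGroup v → B ∈ φ × valueOf B ≡ v
  ∈-valueGroup⁻ {v} B∈ with ∈-filter⁻ (valued? v) (SortByD.∈-sort⁻ _ B∈)
  ... | B∈φ , t = B∈φ , ≡ᵇ⇒≡ _ _ t

  ∈-valueGroup⁺ : ∀ {B} → B ∈ φ → B ∈ valueGroup (valueOf B)
  ∈-valueGroup⁺ {B} B∈ = SortByD.∈-sort⁺ _ (∈-filter⁺ (valued? (valueOf B)) B∈ (≡⇒≡ᵇ (valueOf B) _ refl))

  valueGroup-covers : ∀ p → ∃ λ B → B ∈ valueGroup (lookup w p) × p ∈ˢ B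
  valueGroup-covers p with blocks-cover p
  ... | B , B∈ , p∈ =
    B , subst (λ v → B ∈ valueGroup v) (sym (proj₂ (hasValue B∈) p∈)) (∈-valueGroup⁺ B∈) , p∈

  valueGroup-isValueGroup : ∀ {v} → v ∈ valuesOf w → ValueGroup v (valueGroup v)
  valueGroup-isValueGroup {v} v∈ = inhabited , sorted , All.tabulate valued
    where
    inhabited : NonEmptyList (valueGroup v)
    inhabited with ∈-valuesOf⁻ v∈
    ... | p , wp≡v = subst (NonEmptyList ∘ valueGroup) wp≡v (∈⇒NonEmptyList (proj₁ (proj₂ (valueGroup-covers p))))
    sorted : AllPairs _>ᴰ_ (valueGroup v)
    sorted = SortByD.sort-sorted >D⇒>ᴰ >ᴰ⇒>D >ᴰ-trans _ (AllPairsₚ.filter⁺ (valued? v)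
      (AllPairs-mapWith∈ blocks-disjoint (λ A∈ B∈ A#B →
        >ᴰ-comparable _ _ (Disjoint⇒minElt≢ A#B (All.lookup blocks-nonempty A∈) (All.lookup blocks-nonempty B∈)))))
    valued : ∀ {B} → B ∈ valueGroup v → HasValue v B
    valued {B} B∈ with ∈-valueGroup⁻ B∈
    ... | B∈φ , B≡v = subst (λ u → HasValue u B) B≡v (hasValue B∈φ)

  valueGroups-nonempty : All NonEmptyList valueGroups
  valueGroups-nonempty = Allₚ.map⁺ (All.tabulate (proj₁ ∘ valueGroup-isValueGroup))

  ∈-Φ₀⁻ : ∀ {B} → B ∈ Φ₀ → B ∈ φ
  ∈-Φ₀⁻ B∈ with ∈-concat⁻′ valueGroups B∈
  ... | G , B∈G , G∈ with ∈-map⁻ valueGroup G∈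
  ...   | v , _ , refl = proj₁ (∈-valueGroup⁻ B∈G)

  ∈-Φ₀⁺ : ∀ {B} → B ∈ φ → B ∈ Φ₀
  ∈-Φ₀⁺ B∈ with All.lookup blocks-nonempty B∈
  ... | p , p∈ =
    ∈-concat⁺′ (∈-valueGroup⁺ B∈)
               (∈-map⁺ valueGroup (subst (_∈ valuesOf w) (proj₂ (hasValue B∈) p∈) (∈-valuesOf⁺ p)))

  ⋃valueGroup≡level : ∀ v → unionAll (valueGroup v) ≡ level v
  ⋃valueGroup≡level v = ⊆-antisym ⋃valueGroup⊆level level⊆⋃valueGroup
    where
    ⋃valueGroup⊆level : ∀ {p} → p ∈ˢ unionAll (valueGroup v) → p ∈ˢ level v
    ⋃valueGroup⊆level p∈ with ∈-unionAll⁻ (valueGroup v) p∈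
    ... | B , B∈ , p∈B with ∈-valueGroup⁻ B∈
    ...   | B∈φ , B≡v = ∈-level⁺ (trans (proj₂ (hasValue B∈φ) p∈B) B≡v)
    level⊆⋃valueGroup : ∀ {p} → p ∈ˢ level v → p ∈ˢ unionAll (valueGroup v)
    level⊆⋃valueGroup {p} p∈ with valueGroup-covers p
    ... | B , B∈ , p∈B = ∈-unionAll⁺ (subst (λ u → B ∈ valueGroup u) (∈-level⁻ p∈) B∈) p∈B

  reading₀ : colReading Φ₀ cs₀ ≡ ϱ w
  reading₀ = trans (colReading-columnsOf valueGroups valueGroups-nonempty)
                   (trans (sym (map-∘ (valuesOf w))) (map-cong ⋃valueGroup≡level (valuesOf w)))

  chain₀ : Chain Φ₀ cs₀
  chain₀ = chain-columnsOf valueGroup 1 valuesOf-increasing (All.tabulate valueGroup-isValueGroup)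

  contributes₀ : Contributes Φ₀ cs₀
  contributes₀ = chain⇒isLDD-columnsOf valueGroups valueGroups-nonempty chain₀ , reading₀

  Φ₀-composition : IsSetComposition Φ₀
  Φ₀-composition = record
    { blocks-nonempty = Φ₀-nonempty
    ; blocks-disjoint = AllPairs-mapWith∈ (chain⇒sorted chain₀ Φ₀-nonempty) rowBefore⇒Disjoint
    ; blocks-cover    = λ p → let B , B∈ , p∈ = blocks-cover p in B , ∈-Φ₀⁺ B∈ , p∈
    }
    where
    Φ₀-nonempty : All Nonempty Φ₀
    Φ₀-nonempty = All.tabulate (All.lookup blocks-nonempty ∘ ∈-Φ₀⁻)
    rowBefore⇒Disjoint : ∀ {A B} → A ∈ Φ₀ → B ∈ Φ₀ → RowBefore A B → Disjoint A B
    rowBefore⇒Disjoint A∈ B∈ A≺B with AllPairs-∈ Disjoint-sym blocks-disjoint (∈-Φ₀⁻ A∈) (∈-Φ₀⁻ B∈)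
    ... | inj₁ refl = ⊥-elim (RowBefore-irrefl A≺B)
    ... | inj₂ A#B  = A#B

  sortBlocks₀ : sortBlocks φ ≡ φ → sortBlocks Φ₀ ≡ φ
  sortBlocks₀ φ-sorted = trans (sortBlocks-cong Φ₀-composition φ-composition ∈-Φ₀⁻ ∈-Φ₀⁺) φ-sorted

  cs₀-length : length cs₀ ≡ length Φ₀
  cs₀-length = length-columnsOf 1 valueGroups

  cs₀-bounds : All (λ c → 1 ≤ c × c ≤ length Φ₀) cs₀
  cs₀-bounds = All.tabulate λ c∈ →
    let 1≤c , c≤∣valueGroups∣ = columnsOf-bounds 1 valueGroups c∈
    in 1≤c , ≤-trans (≤-pred c≤∣valueGroups∣) (length≤length-concat valueGroups valueGroups-nonempty)

occursOnce-allFillings : ∀ {n} (Φ : List (Subset n)) cs → length cs ≡ length Φ →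
  All (λ c → 1 ≤ c × c ≤ length Φ) cs → OccursOnce (allFillings Φ) cs
occursOnce-allFillings Φ cs len bounds = occursOnce-listsOf (length Φ) _ cs len (All.map column bounds)
  where
  column : ∀ {c} → 1 ≤ c × c ≤ length Φ → OccursOnce (map suc (upTo (length Φ))) c
  column {suc c} (_ , c<L) = occursOnce-map suc suc-injective {upTo (length Φ)} (occursOnce-upTo c<L)

occursOnce-candidates : ∀ {n} {Φ : List (Subset n)} → IsSetComposition Φ → OccursOnce (candidateCompositions n) Φ
occursOnce-candidates {n} {Φ} Φ-composition f supp = begin
  sum (map f (concatMap (λ k → listsOf k S) (upTo (suc n))))  ≡⟨ sum-concatMap f (λ k → listsOf k S) (upTo (suc n)) ⟩
  sum (map (λ k → sum (map f (listsOf k S))) (upTo (suc n)))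
    ≡⟨ occursOnce-upTo (s≤s (IsSetComposition.length≤n Φ-composition)) _
         (λ k k≢∣Φ∣ → listsOf-vanishes k S Φ f (k≢∣Φ∣ ∘ sym) supp) ⟩
  sum (map f (listsOf (length Φ) S))
    ≡⟨ occursOnce-listsOf (length Φ) S Φ refl (All.tabulate (λ {B} _ → occursOnce-allSubsets n B)) f supp ⟩
  f Φ ∎
  where
  open ≡-Reasoning
  S : List (Subset n)
  S = allSubsets n

module Counting {n : ℕ} (w : Word n) (φ : List (Subset n)) where
  open Levels w
  open Fillings w

  Admissible : List (Subset n) → Set
  Admissible Φ = IsSetComposition Φ × sortBlocks Φ ≡ φ

  fillingTerm : List (Subset n) → List ℕ → ℕ
  fillingTerm Φ cs = if isLDD Φ cs then coeffM (colReading Φ cs) w else 0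

  compositionTerm : List (Subset n) → ℕ
  compositionTerm Φ =
    if isSetComposition Φ ∧ (sortBlocks Φ ==ᶜ φ) then sum (map (fillingTerm Φ) (allFillings Φ)) else 0

  rhs≡candidateSum :
    sum (map (λ Φ → coeffP Φ w) (compositionsOver φ)) ≡ sum (map compositionTerm (candidateCompositions n))
  rhs≡candidateSum =
    trans (sum-map-filter (λ Φ → coeffP Φ w) (λ Φ → isSetComposition Φ ∧ (sortBlocks Φ ==ᶜ φ))
                          (candidateCompositions n))
          (cong sum (map-cong term≡ (candidateCompositions n)))
    where
    term≡ : ∀ Φ → (if isSetComposition Φ ∧ (sortBlocks Φ ==ᶜ φ) then coeffP Φ w else 0) ≡ compositionTerm Φ
    term≡ Φ with isSetComposition Φ ∧ (sortBlocks Φ ==ᶜ φ)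
    ... | true  = sum-map-filter (λ cs → coeffM (colReading Φ cs) w) (isLDD Φ) (allFillings Φ)
    ... | false = refl

  fillingTerm-vanishes : ∀ {Φ cs} → ¬ Contributes Φ cs → fillingTerm Φ cs ≡ 0
  fillingTerm-vanishes {Φ} {cs} ¬contributes with isLDD Φ cs
  ... | false = refl
  ... | true with ϱ w ==ᶜ colReading Φ cs in reads
  ...   | false = refl
  ...   | true  = ⊥-elim (¬contributes (tt , sym (toWitness (≡true⇒T reads))))

  fillingTerm-contributes : ∀ {Φ cs} → Contributes Φ cs → fillingTerm Φ cs ≡ 1
  fillingTerm-contributes {Φ} {cs} (ldd , reading)
    rewrite T⇒≡true ldd
          | T⇒≡true (fromWitness {a? = ListP.≡-dec (Vecₚ.≡-dec BoolP._≟_) (ϱ w) (colReading Φ cs)} (sym reading))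
          = refl

  admissible? : ∀ {Φ} → (isSetComposition Φ ∧ (sortBlocks Φ ==ᶜ φ)) ≡ true → Admissible Φ
  admissible? {Φ} eq with ∧-elim {isSetComposition Φ} (≡true⇒T eq)
  ... | composition , sorted = isSetComposition⇒ Φ composition , toWitness sorted

  compositionTerm-vanishes : ∀ {Φ} → (∀ {cs} → Admissible Φ → ¬ Contributes Φ cs) → compositionTerm Φ ≡ 0
  compositionTerm-vanishes {Φ} none with isSetComposition Φ ∧ (sortBlocks Φ ==ᶜ φ) in adm
  ... | false = refl
  ... | true  = sum-map-≡0 _ (allFillings Φ) (λ {cs} _ → fillingTerm-vanishes {Φ} {cs} (none (admissible? adm)))

  compositionTerm-single : ∀ {Φ cs} → Admissible Φ → Contributes Φ cs →
    (∀ {ds} → Contributes Φ ds → ds ≡ cs) → OccursOnce (allFillings Φ) cs → compositionTerm Φ ≡ 1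
  compositionTerm-single {Φ} {cs} (Φ-composition , Φ-sorted) contributes unique once
    with isSetComposition Φ ∧ (sortBlocks Φ ==ᶜ φ)
       | ∧-intro {isSetComposition Φ} (isSetComposition⇐ Φ-composition)
                 (fromWitness {a? = ListP.≡-dec (Vecₚ.≡-dec BoolP._≟_) (sortBlocks Φ) φ} Φ-sorted)
  ... | true | _ = trans (once (fillingTerm Φ) (λ ds ds≢cs → fillingTerm-vanishes {Φ} {ds} (ds≢cs ∘ unique)))
                         (fillingTerm-contributes {Φ} {cs} contributes)
  ... | false | ()

  admissible⇒⊆ : ∀ {Φ} → Admissible Φ → ∀ {B} → B ∈ Φ → B ∈ φ
  admissible⇒⊆ {Φ} (_ , Φ-sorted) = subst (_ ∈_) Φ-sorted ∘ ∈-sortBlocks⁺ Φ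

  admissible⇒⊇ : ∀ {Φ} → Admissible Φ → ∀ {B} → B ∈ φ → B ∈ Φ
  admissible⇒⊇ {Φ} (_ , Φ-sorted) = ∈-sortBlocks⁻ Φ ∘ subst (_ ∈_) (sym Φ-sorted)

  candidateSum-nonconstant : ¬ T (constantOnBlocks φ w) → sum (map compositionTerm (candidateCompositions n)) ≡ 0
  candidateSum-nonconstant nonconstant =
    sum-map-≡0 compositionTerm (candidateCompositions n) (λ {Φ} _ → compositionTerm-vanishes {Φ} (λ {cs} → none))
    where
    none : ∀ {Φ cs} → Admissible Φ → ¬ Contributes Φ cs
    none {Φ} {cs} admissible contributes = nonconstant (constantOnBlocks⇐ φ
      (All.tabulate (All.lookup (proj₂ (contributes⇒chain {Φ} {cs} contributes)) ∘ admissible⇒⊇ admissible)))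

  candidateSum-constant : IsSetComposition φ → sortBlocks φ ≡ φ → T (constantOnBlocks φ w) →
    sum (map compositionTerm (candidateCompositions n)) ≡ 1
  candidateSum-constant φ-composition φ-sorted constant =
    trans (occursOnce-candidates Φ₀-composition compositionTerm others-vanish)
          (compositionTerm-single (Φ₀-composition , sortBlocks₀ φ-sorted) contributes₀
             (λ {ds} contributes → filling-unique {Φ₀} {ds} Φ₀-nonempty contributes contributes₀)
             (occursOnce-allFillings Φ₀ cs₀ cs₀-length cs₀-bounds))
    where
    open Canonical w φ φ-composition (constantOnBlocks⇒ φ constant)
    Φ₀-nonempty : All Nonempty Φ₀
    Φ₀-nonempty = IsSetComposition.blocks-nonempty Φ₀-composition
    others-vanish : SupportedAt compositionTerm Φ₀
    others-vanish Φ Φ≢Φ₀ = compositionTerm-vanishes {Φ} λ {cs} admissible contributes →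
      Φ≢Φ₀ (proj₁ (contribution-unique (IsSetComposition.blocks-nonempty (proj₁ admissible)) Φ₀-nonempty
                     (∈-Φ₀⁺ ∘ admissible⇒⊆ admissible) (admissible⇒⊇ admissible ∘ ∈-Φ₀⁻)
                     contributes contributes₀))

theorem4p5 : (n : ℕ) (φ : List (Subset n)) → T (isSetPartition φ) →
    (w : Word n) → (∀ (i : Fin n) → 1 ≤ lookup w i) →
    coeffp φ w ≡ sum (map (λ Φ → coeffP Φ w) (compositionsOver φ))
theorem4p5 n φ φ-partition w _ = trans coefficient (sym rhs≡candidateSum)
  where
  open Counting w φ
  φ-composition : IsSetComposition φ
  φ-composition = isSetComposition⇒ φ (proj₁ (∧-elim {isSetComposition φ} φ-partition))
  φ-sorted : sortBlocks φ ≡ φ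
  φ-sorted = toWitness (proj₂ (∧-elim {isSetComposition φ} φ-partition))
  coefficient : coeffp φ w ≡ sum (map compositionTerm (candidateCompositions n))
  coefficient with constantOnBlocks φ w in constant
  ... | true  = sym (candidateSum-constant φ-composition φ-sorted (≡true⇒T constant))
  ... | false = sym (candidateSum-nonconstant (subst T constant))
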